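{- Let $k=12m+4\delta+6\varepsilon$ be an even integer ($m\in\mathbb{Z}$, $\delta\in\{0,1,2\}$, $\varepsilon\in\{0,1\}$), let $n\ge0$, and let $\ell,\ell'$ be integers with $12\ell+4\delta+6\varepsilon\in2\mathbb{Z}_{\ge1}\setminus\{4\}$ and $12\ell'+14-4\delta-6\varepsilon\in2\mathbb{Z}_{\ge1}\setminus\{4\}$. Then \[ \sum_{d=0}^{n} \omega_{k,d}(\ell) F_{2-k,n-d}(X) = \sum_{d=0}^{n} \Omega_{2-k,n-d}(\ell) F_{k,d}(X), \qquad \sum_{d=0}^{n} \omega_{k,d}(\ell) \omega_{2-k,n-d}(\ell') = \sum_{d=0}^{n} \Omega_{2-k,n-d}(\ell) \Omega_{k,d}(\ell'). \]
   Context: Let $q=e^{2\pi i\tau}$, $E_4=1+240\sum\sigma_3(n)q^n$, $E_6=1-504\sum\sigma_5(n)q^n$, $\Delta=(E_4^3-E_6^2)/1728$, $j=E_4^3/\Delta$. Generalized Faber polynomials: write each even integer $\kappa$ uniquely as $\kappa=12\mu+4\delta'+6\varepsilon'$ ($\mu\in\mathbb{Z}$, $\delta'\in\{0,1,2\}$, $\varepsilon'\in\{0,1\}$); for $\ell\ge-\mu$ the unique weakly holomorphic modular form of weight $\kappa$ on $SL_2(\mathbb{Z})$ with expansion $q^{ -\ell}+O(q^{\mu+1})$ equals $E_4^{\delta'}E_6^{\varepsilon'}\Delta^{\mu}F_{\kappa,\ell+\mu}(j)$ with $F_{\kappa,n}$ monic of degree $n$. Atkin-like polynomials: define $a_0(x)=\frac{24(144x^2-41)}{(2x+1)(2x-1)}$,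 $b_0(x)=\frac{36(12x-11)(12x-7)(12x-5)(12x-1)}{x(x-1)(2x-1)^2}$, $a_2(x)=\frac{24(144x^2-29)}{(2x+1)(2x-1)}$, $b_2(x)=\frac{36(12x-13)(12x-7)(12x-5)(12x+1)}{x(x-1)(2x-1)^2}$, $a_{n,0}=a_0(n)$, $b_{n,0}=b_0(n)$, $a_{n,2}=a_2(n)$, $b_{n,2}=b_2(n)$, $a_{n,6}=a_0(n+\tfrac12)$, $b_{n,6}=b_0(n+\tfrac12)$, $a_{n,8}=a_2(n+\tfrac12)$, $b_{n,8}=b_2(n+\tfrac12)$; for $r\in\{0,2,6,8\}$, $A_{n+1,r}=(X-a_{n,r})A_{n,r}-b_{n,r}A_{n-1,r}$ for $n\ge2$ ($r\in\{0,2\}$) resp. $n\ge1$ ($r\in\{6,8\}$), with $A_{0,0}=0$, $A_{1,0}=1$, $A_{2,0}=X-824$; $A_{0,2}=1$, $A_{1,2}=X-720$, $A_{2,2}=X^2-1640X+269280$; $A_{0,6}=1$, $A_{1,6}=X-1266$; $A_{0,8}=1$, $A_{1,8}=X-330$; also $A_{r,4}:=A_{r,0}$, $A_{r,10}:=A_{r,6}$, $A_{r,14}:=A_{r+1,2}$. Expansion coefficients: for any even $\kappa=12\mu+4\delta'+6\varepsilon'$, the numbers $\omega_{\kappa,n}(r)$ and $\Omega_{2-\kappa,n}(r)$ are defined by $F_{\kappa,n}(X)=\sum_r\omega_{\kappa,n}(r)A_{r,4\delta'+6\varepsilon'}(X)$ and $F_{2-\kappa,n}(X)=\sum_r\Omega_{2-\kappa,n}(r)A_{r,4\delta'+6\varepsilon'}(X)$,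 where $r$ runs over the integers with $0\le\deg A_{r,4\delta'+6\varepsilon'}\le n$. (Applied with $\kappa=k$ this defines $\omega_{k,n}$, $\Omega_{2-k,n}$ using $A_{r,4\delta+6\varepsilon}$; applied with $\kappa=2-k=12(-m-1)+4(2-\delta)+6(1-\varepsilon)$ it defines $\omega_{2-k,n}$, $\Omega_{k,n}$ using $A_{r,14-4\delta-6\varepsilon}$.) -}

module Defs where

open import Data.Nat as ℕ using (ℕ; zero; suc)
open import Data.Nat.Divisibility using (_∣?_)
open import Data.Integer as ℤ using (ℤ; +_; -[1+_])
open import Data.Rational as ℚ using (ℚ; 0ℚ; 1ℚ; _+_; _*_; -_; _-_; ≢-nonZero; _÷_)
open import Data.Rational.Properties using () renaming (_≟_ to _≟ℚ_)
open import Data.Fin using (Fin; zero; suc; toℕ)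
open import Data.List using (List; []; _∷_; _++_; length; zipWith)
open import Data.Product using (_×_; _,_; proj₁; proj₂)
open import Relation.Nullary using (yes; no)
open import Relation.Nullary.Decidable using (⌊_⌋)
open import Data.Bool using (if_then_else_)

ℕ→ℚ : ℕ → ℚ
ℕ→ℚ n = (+ n) ℚ./ 1

-- "safe" division: p ÷? q = p / q when q ≠ 0, and 0 otherwise.
-- (It is only ever applied with q ≠ 0 below.)
_÷?_ : ℚ → ℚ → ℚ
p ÷? q with q ≟ℚ 0ℚ
... | yes _  = 0ℚ
... | no q≢0 = _÷_ p q {{≢-nonZero q≢0}}

sumTo : (ℕ → ℚ) → ℕ → ℚ
sumTo f zero    = f zero
sumTo f (suc n) = sumTo f n + f (suc n)

PS : Set
PS = ℕ → ℚ

_⊛_ : PS → PS → PS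
(f ⊛ g) n = sumTo (λ k → f k * g (n ℕ.∸ k)) n

one : PS
one zero    = 1ℚ
one (suc _) = 0ℚ

_^ps_ : PS → ℕ → PS
f ^ps zero  = one
f ^ps suc n = f ⊛ (f ^ps n)

σ : ℕ → ℕ → ℕ
σ k n = go n
  where
  go : ℕ → ℕ
  go zero    = 0
  go (suc d) = go d ℕ.+ (if ⌊ suc d ∣? n ⌋ then suc d ℕ.^ k else 0)

E4 : PS
E4 zero      = 1ℚ
E4 (suc n)   = ℕ→ℚ (240 ℕ.* σ 3 (suc n))

E6 : PS
E6 zero      = 1ℚ
E6 (suc n)   = - ℕ→ℚ (504 ℕ.* σ 5 (suc n))

Δ : PS
Δ n = ((E4 ^ps 3) n - (E6 ^ps 2) n) * ((+ 1) ℚ./ 1728)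

-- Δ = q · D  (Δ has no constant term), D has constant term 1
D : PS
D n = Δ (suc n)

nth : List ℚ → ℕ → ℚ
nth []       _       = 0ℚ
nth (x ∷ _)  zero    = x
nth (_ ∷ xs) (suc i) = nth xs i

-- first n+1 coefficients of 1/f, for f with constant term 1
invList : PS → ℕ → List ℚ
invList f zero    = 1ℚ ∷ []
invList f (suc n) =
  let L = invList f n in
  L ++ ((- sumTo (λ k → f (suc k) * nth L (n ℕ.∸ k)) n) ∷ [])

Dinv : PS
Dinv n = nth (invList D n) n

Dpow : ℤ → PS
Dpow (+ n)    = D ^ps n
Dpow -[1+ n ] = Dinv ^ps suc n

coeffZ : PS → ℤ → ℚ
coeffZ f (+ n)    = f n
coeffZ f -[1+ _ ] = 0ℚ

-- Polynomials in X with rational coefficients, little-endian lists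

Poly : Set
Poly = List ℚ

coeff : Poly → ℕ → ℚ
coeff = nth

X : Poly
X = 0ℚ ∷ 1ℚ ∷ []

_⊕_ : Poly → Poly → Poly
[]       ⊕ q        = q
(x ∷ xs) ⊕ []       = x ∷ xs
(x ∷ xs) ⊕ (y ∷ ys) = (x + y) ∷ (xs ⊕ ys)

_·_ : ℚ → Poly → Poly
c · []       = []
c · (x ∷ xs) = (c * x) ∷ (c · xs)

_⊗_ : Poly → Poly → Poly
[]       ⊗ q = []
(x ∷ xs) ⊗ q = (x · q) ⊕ (0ℚ ∷ (xs ⊗ q))

_⊖_ : Poly → Poly → Poly
p ⊖ q = p ⊕ ((- 1ℚ) · q)

const : ℚ → Poly
const c = c ∷ []

ℕ→ℤ : ℕ → ℤ
ℕ→ℤ = +_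

finℤ : ∀ {k} → Fin k → ℤ
finℤ i = + toℕ i

wt : ℤ → Fin 3 → Fin 2 → ℤ
wt μ δ ε = (+ 12) ℤ.* μ ℤ.+ (+ 4) ℤ.* finℤ δ ℤ.+ (+ 6) ℤ.* finℤ ε

-- coefficient of q^s in  E4^δ' E6^ε' Δ^μ P(j)  for a polynomial P,
-- using  E4^δ' E6^ε' Δ^μ j^i = q^(μ-i) E4^(δ'+3i) E6^ε' D^(μ-i)
-- (j = E4^3/Δ = q^{-1} E4^3 D^{-1}, Δ^μ = q^μ D^μ).
qCoeff : ℤ → Fin 3 → Fin 2 → Poly → ℤ → ℚ
qCoeff μ δ ε P s = go 0 P
  where
  term : ℕ → PS
  term i = ((E4 ^ps (toℕ δ ℕ.+ 3 ℕ.* i)) ⊛ (E6 ^ps toℕ ε)) ⊛ Dpow (μ ℤ.- ℕ→ℤ i)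
  go : ℕ → Poly → ℚ
  go i []       = 0ℚ
  go i (c ∷ cs) = c * coeffZ (term i) (s ℤ.- μ ℤ.+ ℕ→ℤ i) + go (suc i) cs

δℤ : ℤ → ℤ → ℚ
δℤ a b with a ℤ.≟ b
... | yes _ = 1ℚ
... | no  _ = 0ℚ

MonicDeg : ℕ → Poly → Set
MonicDeg n P = (coeff P n ≡ 1ℚ) × (∀ i → n ℕ.< i → coeff P i ≡ 0ℚ)
  where open import Relation.Binary.PropositionalEquality using (_≡_)

-- P = F_{κ,n} for κ = 12μ+4δ'+6ε', ℓ = n - μ:
-- P monic of degree n and E4^δ' E6^ε' Δ^μ P(j) = q^{-ℓ} + O(q^{μ+1}).
IsFaber : ℤ → Fin 3 → Fin 2 → ℕ → Poly → Set
IsFaber μ δ ε n P =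
  MonicDeg n P ×
  (∀ (s : ℤ) → s ℤ.≤ μ → qCoeff μ δ ε P s ≡ δℤ s (μ ℤ.- ℕ→ℤ n))
  where open import Relation.Binary.PropositionalEquality using (_≡_)

a0 b0 a2 b2 : ℚ → ℚ
a0 x = (ℕ→ℚ 24 * (ℕ→ℚ 144 * x * x - ℕ→ℚ 41))
       ÷? ((ℕ→ℚ 2 * x + 1ℚ) * (ℕ→ℚ 2 * x - 1ℚ))
b0 x = (ℕ→ℚ 36 * (ℕ→ℚ 12 * x - ℕ→ℚ 11) * (ℕ→ℚ 12 * x - ℕ→ℚ 7)
                * (ℕ→ℚ 12 * x - ℕ→ℚ 5) * (ℕ→ℚ 12 * x - 1ℚ))
       ÷? (x * (x - 1ℚ) * (ℕ→ℚ 2 * x - 1ℚ) * (ℕ→ℚ 2 * x - 1ℚ))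
a2 x = (ℕ→ℚ 24 * (ℕ→ℚ 144 * x * x - ℕ→ℚ 29))
       ÷? ((ℕ→ℚ 2 * x + 1ℚ) * (ℕ→ℚ 2 * x - 1ℚ))
b2 x = (ℕ→ℚ 36 * (ℕ→ℚ 12 * x - ℕ→ℚ 13) * (ℕ→ℚ 12 * x - ℕ→ℚ 7)
                * (ℕ→ℚ 12 * x - ℕ→ℚ 5) * (ℕ→ℚ 12 * x + 1ℚ))
       ÷? (x * (x - 1ℚ) * (ℕ→ℚ 2 * x - 1ℚ) * (ℕ→ℚ 2 * x - 1ℚ))

half : ℚ
half = (+ 1) ℚ./ 2

-- one step of a three-term recurrence: (A_{n-1}, A_n) ↦ (A_n, A_{n+1})
step : ℚ → ℚ → Poly × Poly → Poly × Poly
step a b (u , v) = v , (((X ⊖ const a) ⊗ v) ⊖ (b · u))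

-- r = 0:  pairs (A_{t+1,0}, A_{t+2,0}); recurrence index n = t+2
pairs0 : ℕ → Poly × Poly
pairs0 zero    = const 1ℚ , (X ⊖ const (ℕ→ℚ 824))
pairs0 (suc t) = step (a0 (ℕ→ℚ (t ℕ.+ 2))) (b0 (ℕ→ℚ (t ℕ.+ 2))) (pairs0 t)

-- r = 2:  pairs (A_{t+1,2}, A_{t+2,2}); recurrence index n = t+2
pairs2 : ℕ → Poly × Poly
pairs2 zero    = (X ⊖ const (ℕ→ℚ 720)) ,
                 ((X ⊗ X) ⊖ (ℕ→ℚ 1640 · X)) ⊕ const (ℕ→ℚ 269280)
pairs2 (suc t) = step (a2 (ℕ→ℚ (t ℕ.+ 2))) (b2 (ℕ→ℚ (t ℕ.+ 2))) (pairs2 t)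

-- r = 6:  pairs (A_{t,6}, A_{t+1,6}); recurrence index n = t+1
pairs6 : ℕ → Poly × Poly
pairs6 zero    = const 1ℚ , (X ⊖ const (ℕ→ℚ 1266))
pairs6 (suc t) = step (a0 (ℕ→ℚ (t ℕ.+ 1) + half)) (b0 (ℕ→ℚ (t ℕ.+ 1) + half)) (pairs6 t)

-- r = 8:  pairs (A_{t,8}, A_{t+1,8}); recurrence index n = t+1
pairs8 : ℕ → Poly × Poly
pairs8 zero    = const 1ℚ , (X ⊖ const (ℕ→ℚ 330))
pairs8 (suc t) = step (a2 (ℕ→ℚ (t ℕ.+ 1) + half)) (b2 (ℕ→ℚ (t ℕ.+ 1) + half)) (pairs8 t)

-- A_{r,0} for r ≥ 1, A_{r,2}, A_{r,6}, A_{r,8} for r ≥ 0   (A_{0,0} = 0)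
A0 : ℕ → Poly
A0 zero    = []
A0 (suc t) = proj₁ (pairs0 t)

A2 : ℕ → Poly
A2 zero    = const 1ℚ
A2 (suc t) = proj₁ (pairs2 t)

A6 : ℕ → Poly
A6 t = proj₁ (pairs6 t)

A8 : ℕ → Poly
A8 t = proj₁ (pairs8 t)

-- For the class c = 4δ'+6ε' ∈ {0,4,8,6,10,14}, the polynomials A_{r,c}
-- (A_{r,4} = A_{r,0}, A_{r,10} = A_{r,6}, A_{r,14} = A_{r+1,2}),
-- listed by degree j: the polynomial of degree j is A_{j + off, c}.
offset : Fin 3 → Fin 2 → ℤ
offset zero             zero       = + 1     -- c = 0  : A_{r,0},   deg r-1
offset (suc zero)       zero       = + 1     -- c = 4  : A_{r,0},   deg r-1
offset (suc (suc zero)) zero       = + 0     -- c = 8  : A_{r,8},   deg r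
offset zero             (suc zero) = + 0     -- c = 6  : A_{r,6},   deg r
offset (suc zero)       (suc zero) = + 0     -- c = 10 : A_{r,6},   deg r
offset (suc (suc zero)) (suc zero) = -[1+ 0 ] -- c = 14 : A_{r+1,2}, deg r+1

byDeg : Fin 3 → Fin 2 → ℕ → Poly
byDeg zero             zero       j = A0 (suc j)
byDeg (suc zero)       zero       j = A0 (suc j)
byDeg (suc (suc zero)) zero       j = A8 j
byDeg zero             (suc zero) j = A6 j
byDeg (suc zero)       (suc zero) j = A6 j
byDeg (suc (suc zero)) (suc zero) j = A2 j

-- Coordinates of a polynomial P of degree ≤ n in a basis B with
-- B j monic of degree j:  P = Σ_{j ≤ n} (coordsDeg B n P j) · B j.
coordsDeg : (ℕ → Poly) → ℕ → Poly → ℕ → ℚ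
coordsDeg B zero    P j with j
... | zero  = coeff P 0
... | suc _ = 0ℚ
coordsDeg B (suc n) P j with j ℕ.≟ suc n
... | yes _ = coeff P (suc n)
... | no  _ = coordsDeg B n (P ⊖ (coeff P (suc n) · B (suc n))) j

-- The coefficient of A_{r,c} (c = 4δ'+6ε') in the expansion
--   P = Σ_{r : 0 ≤ deg A_{r,c} ≤ n} coord δ' ε' n P r · A_{r,c}
-- (taken to be 0 when r is outside that range).
coord : Fin 3 → Fin 2 → ℕ → Poly → ℤ → ℚ
coord δ ε n P r with r ℤ.- offset δ ε
... | -[1+ _ ] = 0ℚ
... | + j with j ℕ.≤? n
...   | yes _ = coordsDeg (byDeg δ ε) n P j
...   | no  _ = 0ℚ

comp3 : Fin 3 → Fin 3
comp3 zero             = suc (suc zero)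
comp3 (suc zero)       = suc zero
comp3 (suc (suc zero)) = zero

comp2 : Fin 2 → Fin 2
comp2 zero       = suc zero
comp2 (suc zero) = zero

-- 12ℓ + 4δ + 6ε ∈ 2ℤ_{≥1} \ {4}  (it is automatically even)
Admissible : Fin 3 → Fin 2 → ℤ → Set
Admissible δ ε ℓ = (+ 1 ℤ.≤ w) × (w ≢ + 4)
  where
  open import Relation.Binary.PropositionalEquality using (_≢_)
  w = (+ 12) ℤ.* ℓ ℤ.+ (+ 4) ℤ.* finℤ δ ℤ.+ (+ 6) ℤ.* finℤ ε

-- Let Λ multiply a sequence of polynomials (aₙ(X)), viewed as Σ aₙ(X) qⁿ, by q·j(q) − Xq.
-- For a Faber family Pₙ = F_{κ,n} with κ = 12μ + 4δ + 6ε, the polynomial (ΛP)ₙ₊₁ has degree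
-- ≤ n + 1, and the defining q-expansions make the coefficients of q^(μ−n−1), …, q^(μ−1) in
-- E₄^δ E₆^ε Δ^μ (ΛP)ₙ₊₁(j) vanish; since these expansions are triangular in the powers of j,
-- (ΛP)ₙ₊₁ is a constant. So Σ Pₙ qⁿ = g_κ(q) / (q·j − Xq) for a scalar series g_κ with constant
-- term 1, whence g_{2−k} · Σ F_{k,n} qⁿ = g_k · Σ F_{2−k,n} qⁿ. Applying two linear functionals
-- (a coefficient of X, or a coordinate in an Atkin-like basis) coefficientwise and
-- cross-multiplying gives both identities.
module Submission where

open import Defs
open import Data.Nat as N using (ℕ; zero; suc; _∸_; _≤_; _<_; z≤n; s≤s)
import Data.Nat.Properties as NP
open import Data.Integer as Z using (ℤ; +_; -[1+_])
import Data.Integer.Properties as ZP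
open import Data.Integer.Tactic.RingSolver using (solve-∀)
open import Data.Rational using (ℚ; 0ℚ; 1ℚ; _+_; _*_; -_; _-_)
import Data.Rational.Properties as QP
open import Data.Rational.Solver using (module +-*-Solver)
open import Data.Fin using (Fin; toℕ) renaming (zero to fzero; suc to fsuc)
open import Data.List using (List; []; _∷_; _++_; length)
import Data.List.Properties as LP
open import Data.Product using (_×_; _,_; proj₁; proj₂)
open import Relation.Nullary using (Dec; yes; no)
open import Relation.Binary.Definitions using (Tri; tri<; tri≈; tri>)
open import Relation.Binary.Bundles using (Setoid)
open import Algebra.Bundles using (CommutativeMonoid)
open import Data.Empty using (⊥-elim)
open import Function using (_∘_)
open import Relation.Binary.PropositionalEquality
open ≡-Reasoning
open +-*-Solver using (solve; _:+_; _:*_; _:-_; _:=_; con)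

open import Algebra.Properties.CommutativeSemigroup NP.+-commutativeSemigroup
  using () renaming (x∙yz≈y∙xz to +-left-commute)
open import Algebra.Properties.CommutativeSemigroup (CommutativeMonoid.commutativeSemigroup QP.*-1-commutativeMonoid)
  using () renaming (x∙yz≈y∙xz to *-left-commute)
open Setoid (ℕ →-setoid ℚ) using () renaming (sym to ≗-sym; trans to ≗-trans)

sumTo-cong : ∀ {f g : ℕ → ℚ} n → (∀ k → k ≤ n → f k ≡ g k) → sumTo f n ≡ sumTo g n
sumTo-cong zero    f≡g = f≡g 0 z≤n
sumTo-cong (suc n) f≡g =
  cong₂ _+_ (sumTo-cong n (λ k k≤n → f≡g k (NP.m≤n⇒m≤1+n k≤n))) (f≡g (suc n) NP.≤-refl)

sumTo-ext : ∀ {f g : ℕ → ℚ} n → f ≗ g → sumTo f n ≡ sumTo g n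
sumTo-ext n f≗g = sumTo-cong n (λ k _ → f≗g k)

sumTo-zero : ∀ {f : ℕ → ℚ} n → (∀ k → k ≤ n → f k ≡ 0ℚ) → sumTo f n ≡ 0ℚ
sumTo-zero zero    f≡0 = f≡0 0 z≤n
sumTo-zero (suc n) f≡0 =
  cong₂ _+_ (sumTo-zero n (λ k k≤n → f≡0 k (NP.m≤n⇒m≤1+n k≤n))) (f≡0 (suc n) NP.≤-refl)

sumTo-+ : ∀ (f g : ℕ → ℚ) n → sumTo (λ k → f k + g k) n ≡ sumTo f n + sumTo g n
sumTo-+ f g zero    = refl
sumTo-+ f g (suc n) = trans (cong (_+ (f (suc n) + g (suc n))) (sumTo-+ f g n))
  (solve 4 (λ a b c d → (a :+ b) :+ (c :+ d) := (a :+ c) :+ (b :+ d)) refl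
    (sumTo f n) (sumTo g n) (f (suc n)) (g (suc n)))

sumTo-neg : ∀ (f : ℕ → ℚ) n → sumTo (λ k → - f k) n ≡ - sumTo f n
sumTo-neg f zero    = refl
sumTo-neg f (suc n) =
  trans (cong (_+ (- f (suc n))) (sumTo-neg f n)) (sym (QP.neg-distrib-+ (sumTo f n) (f (suc n))))

sumTo-sub-add : ∀ (f g h : ℕ → ℚ) n →
  sumTo (λ k → f k - g k + h k) n ≡ sumTo f n - sumTo g n + sumTo h n
sumTo-sub-add f g h n = trans (sumTo-+ (λ k → f k - g k) h n)
  (cong (_+ sumTo h n) (trans (sumTo-+ f (λ k → - g k) n) (cong (λ z → sumTo f n + z) (sumTo-neg g n))))

sumTo-*ˡ : ∀ c (f : ℕ → ℚ) n → sumTo (λ k → c * f k) n ≡ c * sumTo f n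
sumTo-*ˡ c f zero    = refl
sumTo-*ˡ c f (suc n) =
  trans (cong (_+ (c * f (suc n))) (sumTo-*ˡ c f n)) (sym (QP.*-distribˡ-+ c (sumTo f n) (f (suc n))))

sumTo-*ʳ : ∀ c (f : ℕ → ℚ) n → sumTo (λ k → f k * c) n ≡ sumTo f n * c
sumTo-*ʳ c f n = begin
  sumTo (λ k → f k * c) n  ≡⟨ sumTo-ext n (λ k → QP.*-comm (f k) c) ⟩
  sumTo (λ k → c * f k) n  ≡⟨ sumTo-*ˡ c f n ⟩
  c * sumTo f n            ≡⟨ QP.*-comm c (sumTo f n) ⟩
  sumTo f n * c            ∎

sumTo-suc : ∀ (f : ℕ → ℚ) n → sumTo f (suc n) ≡ f 0 + sumTo (λ k → f (suc k)) n
sumTo-suc f zero    = refl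
sumTo-suc f (suc n) = trans (cong (_+ f (suc (suc n))) (sumTo-suc f n)) (QP.+-assoc (f 0) _ _)

sumTo-reverse : ∀ (f : ℕ → ℚ) n → sumTo (λ k → f (n ∸ k)) n ≡ sumTo f n
sumTo-reverse f zero    = refl
sumTo-reverse f (suc n) = begin
  sumTo (λ k → f (suc n ∸ k)) n + f (n ∸ n)
    ≡⟨ cong₂ _+_ (sumTo-cong n (λ k k≤n → cong f (NP.+-∸-assoc 1 k≤n))) (cong f (NP.n∸n≡0 n)) ⟩
  sumTo (λ k → f (suc (n ∸ k))) n + f 0
    ≡⟨ cong (_+ f 0) (sumTo-reverse (λ k → f (suc k)) n) ⟩
  sumTo (λ k → f (suc k)) n + f 0
    ≡⟨ QP.+-comm _ (f 0) ⟩
  f 0 + sumTo (λ k → f (suc k)) n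
    ≡⟨ sym (sumTo-suc f n) ⟩
  sumTo f (suc n) ∎

sumTo-single : ∀ (f : ℕ → ℚ) n j → j ≤ n → (∀ k → k ≤ n → k ≢ j → f k ≡ 0ℚ) → sumTo f n ≡ f j
sumTo-single f zero zero _ _ = refl
sumTo-single f (suc n) j j≤1+n f≡0 with j N.≟ suc n
... | yes refl = trans (cong (_+ f (suc n)) rest≡0) (QP.+-identityˡ _)
  where
  rest≡0 = sumTo-zero n (λ k k≤n → f≡0 k (NP.m≤n⇒m≤1+n k≤n) (NP.<⇒≢ (s≤s k≤n)))
... | no j≢1+n = trans
  (cong₂ _+_ (sumTo-single f n j (NP.≤-pred (NP.≤∧≢⇒< j≤1+n j≢1+n)) (λ k k≤n → f≡0 k (NP.m≤n⇒m≤1+n k≤n)))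
             (f≡0 (suc n) NP.≤-refl (j≢1+n ∘ sym)))
  (QP.+-identityʳ _)

sumTo-swap : ∀ (f : ℕ → ℕ → ℚ) n m →
  sumTo (λ a → sumTo (f a) m) n ≡ sumTo (λ b → sumTo (λ a → f a b) n) m
sumTo-swap f zero    m = refl
sumTo-swap f (suc n) m = begin
  sumTo (λ a → sumTo (f a) m) n + sumTo (f (suc n)) m
    ≡⟨ cong (_+ sumTo (f (suc n)) m) (sumTo-swap f n m) ⟩
  sumTo (λ b → sumTo (λ a → f a b) n) m + sumTo (f (suc n)) m
    ≡⟨ sym (sumTo-+ (λ b → sumTo (λ a → f a b) n) (f (suc n)) m) ⟩
  sumTo (λ b → sumTo (λ a → f a b) (suc n)) m ∎

sumTo-triangle : ∀ (G : ℕ → ℕ → ℚ) n →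
  sumTo (λ c → sumTo (λ a → G a c) c) n ≡ sumTo (λ a → sumTo (λ b → G a (a N.+ b)) (n ∸ a)) n
sumTo-triangle G zero    = refl
sumTo-triangle G (suc n) = begin
  sumTo (λ c → sumTo (λ a → G a c) c) n + (sumTo (λ a → G a (suc n)) n + G (suc n) (suc n))
    ≡⟨ cong (_+ (sumTo (λ a → G a (suc n)) n + G (suc n) (suc n))) (sumTo-triangle G n) ⟩
  Rows n + (sumTo (λ a → G a (suc n)) n + G (suc n) (suc n))
    ≡⟨ sym (QP.+-assoc (Rows n) _ _) ⟩
  (Rows n + sumTo (λ a → G a (suc n)) n) + G (suc n) (suc n)
    ≡⟨ cong₂ _+_ (sym (sumTo-+ (λ a → Row a (n ∸ a)) (λ a → G a (suc n)) n))
                 (cong (G (suc n)) (sym (NP.+-identityʳ (suc n)))) ⟩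
  sumTo (λ a → Row a (n ∸ a) + G a (suc n)) n + G (suc n) (suc n N.+ 0)
    ≡⟨ cong (_+ G (suc n) (suc n N.+ 0)) (sumTo-cong n extendRow) ⟩
  sumTo (λ a → Row a (suc n ∸ a)) n + Row (suc n) 0
    ≡⟨ cong (λ z → sumTo (λ a → Row a (suc n ∸ a)) n + Row (suc n) z) (sym (NP.n∸n≡0 n)) ⟩
  sumTo (λ a → Row a (suc n ∸ a)) (suc n) ∎
  where
  Row : ℕ → ℕ → ℚ
  Row a = sumTo (λ b → G a (a N.+ b))
  Rows : ℕ → ℚ
  Rows n = sumTo (λ a → Row a (n ∸ a)) n
  extendRow : ∀ a → a ≤ n → Row a (n ∸ a) + G a (suc n) ≡ Row a (suc n ∸ a)
  extendRow a a≤n = begin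
    Row a (n ∸ a) + G a (suc n)
      ≡⟨ cong (λ z → Row a (n ∸ a) + G a z) (sym (trans (NP.+-suc a (n ∸ a)) (cong suc (NP.m+[n∸m]≡n a≤n)))) ⟩
    Row a (suc (n ∸ a))
      ≡⟨ cong (Row a) (sym (NP.+-∸-assoc 1 a≤n)) ⟩
    Row a (suc n ∸ a) ∎

sumTo-triangle-swap : ∀ (f : ℕ → ℕ → ℚ) n →
  sumTo (λ a → sumTo (f a) (n ∸ a)) n ≡ sumTo (λ b → sumTo (λ a → f a b) (n ∸ b)) n
sumTo-triangle-swap f n = begin
  sumTo (λ a → sumTo (f a) (n ∸ a)) n
    ≡⟨ sumTo-ext n (λ a → sumTo-ext (n ∸ a) (λ b → cong (f a) (sym (NP.m+n∸m≡n a b)))) ⟩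
  sumTo (λ a → sumTo (λ b → f a ((a N.+ b) ∸ a)) (n ∸ a)) n
    ≡⟨ sym (sumTo-triangle (λ a c → f a (c ∸ a)) n) ⟩
  sumTo (λ c → sumTo (λ a → f a (c ∸ a)) c) n
    ≡⟨ sumTo-ext n (λ c → trans (sym (sumTo-reverse (λ a → f a (c ∸ a)) c))
                         (sumTo-cong c (λ b b≤c → cong (f (c ∸ b)) (NP.m∸[m∸n]≡n b≤c)))) ⟩
  sumTo (λ c → sumTo (λ b → f (c ∸ b) b) c) n
    ≡⟨ sumTo-triangle (λ b c → f (c ∸ b) b) n ⟩
  sumTo (λ b → sumTo (λ a → f ((b N.+ a) ∸ b) b) (n ∸ b)) n
    ≡⟨ sumTo-ext n (λ b → sumTo-ext (n ∸ b) (λ a → cong (λ z → f z b) (NP.m+n∸m≡n b a))) ⟩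
  sumTo (λ b → sumTo (λ a → f a b) (n ∸ b)) n ∎

-- Formal power series

⊛-cong : ∀ {f f′ g g′ : PS} → f ≗ f′ → g ≗ g′ → (f ⊛ g) ≗ (f′ ⊛ g′)
⊛-cong f≗f′ g≗g′ n = sumTo-ext n (λ k → cong₂ _*_ (f≗f′ k) (g≗g′ (n ∸ k)))

⊛-congˡ : ∀ {f f′ : PS} (g : PS) → f ≗ f′ → (f ⊛ g) ≗ (f′ ⊛ g)
⊛-congˡ {f} {f′} g f≗f′ = ⊛-cong {f} {f′} {g} {g} f≗f′ (λ _ → refl)

⊛-congʳ : ∀ (f : PS) {g g′ : PS} → g ≗ g′ → (f ⊛ g) ≗ (f ⊛ g′)
⊛-congʳ f {g} {g′} g≗g′ = ⊛-cong {f} {f} {g} {g′} (λ _ → refl) g≗g′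

⊛-comm : ∀ (f g : PS) → (f ⊛ g) ≗ (g ⊛ f)
⊛-comm f g n = begin
  sumTo (λ k → f k * g (n ∸ k)) n
    ≡⟨ sym (sumTo-reverse (λ k → f k * g (n ∸ k)) n) ⟩
  sumTo (λ k → f (n ∸ k) * g (n ∸ (n ∸ k))) n
    ≡⟨ sumTo-cong n (λ k k≤n → trans (cong (λ z → f (n ∸ k) * g z) (NP.m∸[m∸n]≡n k≤n))
                                     (QP.*-comm (f (n ∸ k)) (g k))) ⟩
  sumTo (λ k → g k * f (n ∸ k)) n ∎

⊛-assoc : ∀ (f g h : PS) → ((f ⊛ g) ⊛ h) ≗ (f ⊛ (g ⊛ h))
⊛-assoc f g h n = begin
  sumTo (λ c → sumTo (λ a → f a * g (c ∸ a)) c * h (n ∸ c)) n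
    ≡⟨ sumTo-ext n (λ c → sym (sumTo-*ʳ (h (n ∸ c)) (λ a → f a * g (c ∸ a)) c)) ⟩
  sumTo (λ c → sumTo (λ a → f a * g (c ∸ a) * h (n ∸ c)) c) n
    ≡⟨ sumTo-triangle (λ a c → f a * g (c ∸ a) * h (n ∸ c)) n ⟩
  sumTo (λ a → sumTo (λ b → f a * g ((a N.+ b) ∸ a) * h (n ∸ (a N.+ b))) (n ∸ a)) n
    ≡⟨ sumTo-ext n (λ a → trans (sumTo-ext (n ∸ a) (λ b →
          trans (cong₂ (λ u v → f a * g u * h v) (NP.m+n∸m≡n a b) (sym (NP.∸-+-assoc n a b)))
                (QP.*-assoc (f a) (g b) (h (n ∸ a ∸ b)))))
          (sumTo-*ˡ (f a) (λ b → g b * h (n ∸ a ∸ b)) (n ∸ a))) ⟩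
  sumTo (λ a → f a * sumTo (λ b → g b * h (n ∸ a ∸ b)) (n ∸ a)) n ∎

⊛-interchange : ∀ (a b c d : PS) → ((a ⊛ b) ⊛ (c ⊛ d)) ≗ ((a ⊛ c) ⊛ (b ⊛ d))
⊛-interchange a b c d =
  ≗-trans (⊛-assoc a b (c ⊛ d))
  (≗-trans (⊛-congʳ a (≗-sym (⊛-assoc b c d)))
  (≗-trans (⊛-congʳ a (⊛-congˡ d (⊛-comm b c)))
  (≗-trans (⊛-congʳ a (⊛-assoc c b d))
  (≗-sym (⊛-assoc a c (b ⊛ d))))))

one-≢0 : ∀ k → k ≢ 0 → one k ≡ 0ℚ
one-≢0 zero    k≢0 = ⊥-elim (k≢0 refl)
one-≢0 (suc k) _   = refl

⊛-identityˡ : ∀ (f : PS) → (one ⊛ f) ≗ f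
⊛-identityˡ f n = trans
  (sumTo-single (λ k → one k * f (n ∸ k)) n 0 z≤n
    (λ k _ k≢0 → trans (cong (_* f (n ∸ k)) (one-≢0 k k≢0)) (QP.*-zeroˡ (f (n ∸ k)))))
  (QP.*-identityˡ (f n))

⊛-identityʳ : ∀ (f : PS) → (f ⊛ one) ≗ f
⊛-identityʳ f = ≗-trans (⊛-comm f one) (⊛-identityˡ f)

⊛-sumTo : ∀ (J : PS) (c : ℕ → ℚ) (g : ℕ → PS) N →
  (J ⊛ (λ w → sumTo (λ i → c i * g i w) N)) ≗ (λ w → sumTo (λ i → c i * (J ⊛ g i) w) N)
⊛-sumTo J c g N w = begin
  sumTo (λ v → J v * sumTo (λ i → c i * g i (w ∸ v)) N) w
    ≡⟨ sumTo-ext w (λ v → sym (sumTo-*ˡ (J v) (λ i → c i * g i (w ∸ v)) N)) ⟩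
  sumTo (λ v → sumTo (λ i → J v * (c i * g i (w ∸ v))) N) w
    ≡⟨ sumTo-swap (λ v i → J v * (c i * g i (w ∸ v))) w N ⟩
  sumTo (λ i → sumTo (λ v → J v * (c i * g i (w ∸ v))) w) N
    ≡⟨ sumTo-ext N (λ i → trans (sumTo-ext w (λ v →
          *-left-commute (J v) (c i) (g i (w ∸ v))))
          (sumTo-*ˡ (c i) (λ v → J v * g i (w ∸ v)) w)) ⟩
  sumTo (λ i → c i * sumTo (λ v → J v * g i (w ∸ v)) w) N ∎

^ps-+ : ∀ (f : PS) a b → (f ^ps (a N.+ b)) ≗ ((f ^ps a) ⊛ (f ^ps b))
^ps-+ f zero    b = ≗-sym (⊛-identityˡ (f ^ps b))
^ps-+ f (suc a) b = ≗-trans (⊛-congʳ f (^ps-+ f a b)) (≗-sym (⊛-assoc f (f ^ps a) (f ^ps b)))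

⊛-constant : ∀ (f g : PS) → f 0 ≡ 1ℚ → g 0 ≡ 1ℚ → (f ⊛ g) 0 ≡ 1ℚ
⊛-constant f g f0≡1 g0≡1 = cong₂ _*_ f0≡1 g0≡1

^ps-constant : ∀ (f : PS) → f 0 ≡ 1ℚ → ∀ n → (f ^ps n) 0 ≡ 1ℚ
^ps-constant f f0≡1 zero    = refl
^ps-constant f f0≡1 (suc n) = ⊛-constant f (f ^ps n) f0≡1 (^ps-constant f f0≡1 n)

⊛-cancelˡ : ∀ (c u v : PS) → c 0 ≡ 1ℚ → (c ⊛ u) ≗ (c ⊛ v) → u ≗ v
⊛-cancelˡ c u v c0≡1 cu≗cv n = below n n NP.≤-refl
  where
  uc≗vc : (u ⊛ c) ≗ (v ⊛ c)
  uc≗vc m = trans (⊛-comm u c m) (trans (cu≗cv m) (⊛-comm c v m))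
  lead : ∀ (w : PS) m → w m * c (m ∸ m) ≡ w m
  lead w m = trans (cong (λ z → w m * c z) (NP.n∸n≡0 m)) (trans (cong (w m *_) c0≡1) (QP.*-identityʳ (w m)))
  peel : ∀ (w : PS) m → w (suc m) ≡ (w ⊛ c) (suc m) - sumTo (λ k → w k * c (suc m ∸ k)) m
  peel w m = trans (sym (lead w (suc m)))
    (solve 2 (λ x y → x := y :+ x :- y) refl (w (suc m) * c (m ∸ m)) (sumTo (λ k → w k * c (suc m ∸ k)) m))
  below : ∀ N m → m ≤ N → u m ≡ v m
  below N zero _ = trans (sym (lead u 0)) (trans (uc≗vc 0) (lead v 0))
  below (suc N) (suc m) (s≤s m≤N) = begin
    u (suc m)
      ≡⟨ peel u m ⟩
    (u ⊛ c) (suc m) - sumTo (λ k → u k * c (suc m ∸ k)) m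
      ≡⟨ cong₂ _-_ (uc≗vc (suc m)) (sumTo-cong m (λ k k≤m → cong (_* c (suc m ∸ k)) (below N k (NP.≤-trans k≤m m≤N)))) ⟩
    (v ⊛ c) (suc m) - sumTo (λ k → v k * c (suc m ∸ k)) m
      ≡⟨ sym (peel v m) ⟩
    v (suc m) ∎

⊛-cross-multiply : ∀ (a b φa φb ψa ψb : PS) → a 0 ≡ 1ℚ → b 0 ≡ 1ℚ →
  (b ⊛ φa) ≗ (a ⊛ φb) → (b ⊛ ψa) ≗ (a ⊛ ψb) → (φa ⊛ ψb) ≗ (ψa ⊛ φb)
⊛-cross-multiply a b φa φb ψa ψb a0≡1 b0≡1 φ-eq ψ-eq =
  ⊛-cancelˡ (b ⊛ a) (φa ⊛ ψb) (ψa ⊛ φb) (⊛-constant b a b0≡1 a0≡1)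
  (≗-trans (⊛-interchange b a φa ψb)
  (≗-trans (⊛-congˡ (a ⊛ ψb) φ-eq)
  (≗-trans (⊛-comm (a ⊛ φb) (a ⊛ ψb))
  (≗-trans (⊛-congˡ (a ⊛ φb) (≗-sym ψ-eq))
  (≗-sym (⊛-interchange b a ψa φb))))))

monomial : ℕ → PS
monomial a w with a N.≟ w
... | yes _ = 1ℚ
... | no  _ = 0ℚ

monomial-≢ : ∀ a w → a ≢ w → monomial a w ≡ 0ℚ
monomial-≢ a w a≢w with a N.≟ w
... | yes a≡w = ⊥-elim (a≢w a≡w)
... | no  _   = refl

monomial-refl : ∀ a → monomial a a ≡ 1ℚ
monomial-refl a with a N.≟ a
... | yes _   = refl
... | no  a≢a = ⊥-elim (a≢a refl)

monomial-≡ : ∀ {a b} → a ≡ b → monomial a b ≡ 1ℚ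
monomial-≡ {a} refl = monomial-refl a

monomial-∸-self : ∀ {x n} → x ≤ n → monomial (n ∸ x) n ≡ one x
monomial-∸-self {zero}  {n} _   = monomial-refl n
monomial-∸-self {suc x} {n} x<n = monomial-≢ (n ∸ suc x) n (NP.<⇒≢ (NP.∸-monoʳ-< (s≤s z≤n) x<n))

monomial-⊛-term : ∀ a (f : PS) w k → k ≢ a → monomial a k * f (w ∸ k) ≡ 0ℚ
monomial-⊛-term a f w k k≢a = trans (cong (_* f (w ∸ k)) (monomial-≢ a k (k≢a ∘ sym))) (QP.*-zeroˡ (f (w ∸ k)))

monomial-⊛-≥ : ∀ a (f : PS) w → a ≤ w → (monomial a ⊛ f) w ≡ f (w ∸ a)
monomial-⊛-≥ a f w a≤w = begin
  sumTo (λ k → monomial a k * f (w ∸ k)) w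
    ≡⟨ sumTo-single (λ k → monomial a k * f (w ∸ k)) w a a≤w (λ k _ → monomial-⊛-term a f w k) ⟩
  monomial a a * f (w ∸ a)
    ≡⟨ trans (cong (_* f (w ∸ a)) (monomial-refl a)) (QP.*-identityˡ _) ⟩
  f (w ∸ a) ∎

monomial-⊛-< : ∀ a (f : PS) w → w < a → (monomial a ⊛ f) w ≡ 0ℚ
monomial-⊛-< a f w w<a =
  sumTo-zero w (λ k k≤w → monomial-⊛-term a f w k (λ k≡a → NP.<⇒≱ w<a (subst (_≤ w) k≡a k≤w)))

monomial-⊛ : ∀ a (f : PS) w → (monomial a ⊛ f) w ≡ coeffZ f (+ w Z.- + a)
monomial-⊛ a f w with a N.≤? w
... | yes a≤w = trans (monomial-⊛-≥ a f w a≤w)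
                      (cong (coeffZ f) (sym (trans (ZP.m-n≡m⊖n w a) (ZP.⊖-≥ a≤w))))
... | no  a≰w = trans (monomial-⊛-< a f w w<a)
                      (cong (coeffZ f) (sym (trans (ZP.m-n≡m⊖n w a) (trans (ZP.⊖-< w<a) (negative (a ∸ w) (NP.m>n⇒m∸n≢0 w<a))))))
  where
  w<a = NP.≰⇒> a≰w
  negative : ∀ m → m ≢ 0 → Z.- (+ m) ≡ -[1+ N.pred m ]
  negative zero    m≢0 = ⊥-elim (m≢0 refl)
  negative (suc m) _   = refl

-- The series D⁻¹ and the q-expansions of E₄^δ E₆^ε Δ^μ jⁱ

nth-++ : ∀ (L M : List ℚ) i → i < length L → nth (L ++ M) i ≡ nth L i
nth-++ (x ∷ L) M zero    _         = refl
nth-++ (x ∷ L) M (suc i) (s≤s i<L) = nth-++ L M i i<L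

nth-++-length : ∀ (L : List ℚ) x → nth (L ++ x ∷ []) (length L) ≡ x
nth-++-length []      x = refl
nth-++-length (y ∷ L) x = nth-++-length L x

invList-length : ∀ f n → length (invList f n) ≡ suc n
invList-length f zero    = refl
invList-length f (suc n) =
  trans (LP.length-++ (invList f n)) (trans (cong (N._+ 1) (invList-length f n)) (NP.+-comm (suc n) 1))

invList-prefix : ∀ f n i → i ≤ n → nth (invList f n) i ≡ nth (invList f i) i
invList-prefix f zero zero _ = refl
invList-prefix f (suc n) i i≤1+n with i N.≟ suc n
... | yes refl = refl
... | no  i≢1+n = trans (nth-++ (invList f n) _ i (subst (i <_) (sym (invList-length f n)) i<1+n))
                        (invList-prefix f n i (NP.≤-pred i<1+n))
  where
  i<1+n = NP.≤∧≢⇒< i≤1+n i≢1+n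

Dinv-suc : ∀ n → Dinv (suc n) ≡ - sumTo (λ k → D (suc k) * Dinv (n ∸ k)) n
Dinv-suc n = begin
  nth (invList D n ++ new ∷ []) (suc n)
    ≡⟨ cong (nth (invList D n ++ new ∷ [])) (sym (invList-length D n)) ⟩
  nth (invList D n ++ new ∷ []) (length (invList D n))
    ≡⟨ nth-++-length (invList D n) new ⟩
  new
    ≡⟨ cong -_ (sumTo-ext n (λ k → cong (D (suc k) *_) (invList-prefix D n (n ∸ k) (NP.m∸n≤m n k)))) ⟩
  - sumTo (λ k → D (suc k) * Dinv (n ∸ k)) n ∎
  where
  new = - sumTo (λ k → D (suc k) * nth (invList D n) (n ∸ k)) n

D⊛Dinv : (D ⊛ Dinv) ≗ one
D⊛Dinv zero    = refl
D⊛Dinv (suc n) = begin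
  sumTo (λ k → D k * Dinv (suc n ∸ k)) (suc n)
    ≡⟨ sumTo-suc (λ k → D k * Dinv (suc n ∸ k)) n ⟩
  D 0 * Dinv (suc n) + tail
    ≡⟨ cong (_+ tail) (trans (QP.*-identityˡ (Dinv (suc n))) (Dinv-suc n)) ⟩
  - tail + tail
    ≡⟨ QP.+-inverseˡ tail ⟩
  0ℚ ∎
  where
  tail = sumTo (λ k → D (suc k) * Dinv (n ∸ k)) n

Dpow-pred : ∀ e → Dpow (e Z.- + 1) ≗ (Dinv ⊛ Dpow e)
Dpow-pred (+ zero)  n = refl
Dpow-pred (+ suc k)   =
  ≗-trans (≗-sym (⊛-identityˡ (D ^ps k)))
  (≗-trans (⊛-congˡ (D ^ps k) (≗-sym (≗-trans (⊛-comm Dinv D) D⊛Dinv)))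
           (⊛-assoc Dinv D (D ^ps k)))
Dpow-pred -[1+ k ]    = ⊛-congʳ Dinv (λ w → cong (λ z → (Dinv ^ps suc z) w) (NP.+-identityʳ k))

Dpow-constant : ∀ e → Dpow e 0 ≡ 1ℚ
Dpow-constant (+ n)    = ^ps-constant D refl n
Dpow-constant -[1+ n ] = ^ps-constant Dinv refl (suc n)

-- q·j = E₄³ / D
qj : PS
qj = (E4 ^ps 3) ⊛ Dinv

-- E₄^δ E₆^ε Δ^μ jⁱ = q^(μ - i) · jTerm μ δ ε i, as in the local `term` of qCoeff
jTerm : ℤ → Fin 3 → Fin 2 → ℕ → PS
jTerm μ δ ε i = ((E4 ^ps (toℕ δ N.+ 3 N.* i)) ⊛ (E6 ^ps toℕ ε)) ⊛ Dpow (μ Z.- + i)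

jTerm-constant : ∀ μ δ ε i → jTerm μ δ ε i 0 ≡ 1ℚ
jTerm-constant μ δ ε i =
  cong₂ _*_ (cong₂ _*_ (^ps-constant E4 refl (toℕ δ N.+ 3 N.* i)) (^ps-constant E6 refl (toℕ ε)))
            (Dpow-constant (μ Z.- + i))

jTerm-suc : ∀ μ δ ε i → jTerm μ δ ε (suc i) ≗ (qj ⊛ jTerm μ δ ε i)
jTerm-suc μ δ ε i =
  ≗-trans (⊛-cong {g′ = Dinv ⊛ Dμ} (⊛-congˡ E6ε E4-split) Dpow-split)
  (≗-trans (⊛-congˡ (Dinv ⊛ Dμ) (⊛-assoc (E4 ^ps 3) E4i E6ε))
  (⊛-interchange (E4 ^ps 3) (E4i ⊛ E6ε) Dinv Dμ))
  where
  E4i  = E4 ^ps (toℕ δ N.+ 3 N.* i)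
  E6ε  = E6 ^ps toℕ ε
  Dμ   = Dpow (μ Z.- + i)
  E4-split : (E4 ^ps (toℕ δ N.+ 3 N.* suc i)) ≗ ((E4 ^ps 3) ⊛ E4i)
  E4-split w = trans (cong (λ z → (E4 ^ps z) w) exponent) (^ps-+ E4 3 (toℕ δ N.+ 3 N.* i) w)
    where
    exponent : toℕ δ N.+ 3 N.* suc i ≡ 3 N.+ (toℕ δ N.+ 3 N.* i)
    exponent = begin
      toℕ δ N.+ 3 N.* suc i      ≡⟨ cong (toℕ δ N.+_) (NP.*-suc 3 i) ⟩
      toℕ δ N.+ (3 N.+ 3 N.* i)  ≡⟨ +-left-commute (toℕ δ) 3 (3 N.* i) ⟩
      3 N.+ (toℕ δ N.+ 3 N.* i)  ∎
  Dpow-split : Dpow (μ Z.- + suc i) ≗ (Dinv ⊛ Dμ)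
  Dpow-split w = trans (cong (λ z → Dpow z w) (sub-suc μ (+ i))) (Dpow-pred (μ Z.- + i) w)
    where
    sub-suc : ∀ μ x → μ Z.- (+ 1 Z.+ x) ≡ (μ Z.- x) Z.- + 1
    sub-suc = solve-∀

-- Low-order q-expansion coefficients of E₄^δ E₆^ε Δ^μ P(j)

jCoeff : ℤ → Fin 3 → Fin 2 → ℤ → ℕ → ℚ
jCoeff μ δ ε s i = coeffZ (jTerm μ δ ε i) (s Z.- μ Z.+ + i)

qCoeffFrom : ℤ → Fin 3 → Fin 2 → ℤ → ℕ → Poly → ℚ
qCoeffFrom μ δ ε s i []       = 0ℚ
qCoeffFrom μ δ ε s i (c ∷ cs) = c * jCoeff μ δ ε s i + qCoeffFrom μ δ ε s (suc i) cs

-- The local recursion of qCoeff cannot be named; abstracting the polynomial it closes over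
-- (the `with`) lets the meta in the type of `local` stand for it.
qCoeff-unfold : ∀ μ δ ε P s → qCoeff μ δ ε P s ≡ qCoeffFrom μ δ ε s 0 P
qCoeff-unfold μ δ ε []       s = refl
qCoeff-unfold μ δ ε (c ∷ cs) s = unfold c cs
  where
  local : (Q : Poly) (i : ℕ) (L : Poly) → _ ≡ qCoeffFrom μ δ ε s i L
  local Q i []       = refl
  local Q i (d ∷ ds) = cong (_+_ (d * jCoeff μ δ ε s i)) (local Q (suc i) ds)
  unfold : (c : ℚ) (cs : Poly) → qCoeff μ δ ε (c ∷ cs) s ≡ qCoeffFrom μ δ ε s 0 (c ∷ cs)
  unfold c cs with suc zero | cs | c ∷ cs
  ... | i | L | Q = cong (_+_ (c * jCoeff μ δ ε s 0)) (local Q i L)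

qCoeffFrom-sumTo : ∀ μ δ ε s N j P → (∀ k → N < k → nth P k ≡ 0ℚ) →
  qCoeffFrom μ δ ε s j P ≡ sumTo (λ k → nth P k * jCoeff μ δ ε s (j N.+ k)) N
qCoeffFrom-sumTo μ δ ε s N j [] _ = sym (sumTo-zero N (λ k _ → QP.*-zeroˡ (jCoeff μ δ ε s (j N.+ k))))
qCoeffFrom-sumTo μ δ ε s zero j (c ∷ cs) high≡0 = begin
  c * V j + qCoeffFrom μ δ ε s (suc j) cs
    ≡⟨ cong₂ _+_ (cong (λ z → c * V z) (sym (NP.+-identityʳ j)))
         (trans (qCoeffFrom-sumTo μ δ ε s zero (suc j) cs (λ k _ → high≡0 (suc k) (s≤s z≤n)))
                (trans (cong (_* V (suc j N.+ 0)) (high≡0 1 (s≤s z≤n))) (QP.*-zeroˡ (V (suc j N.+ 0))))) ⟩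
  c * V (j N.+ 0) + 0ℚ
    ≡⟨ QP.+-identityʳ _ ⟩
  c * V (j N.+ 0) ∎
  where V = jCoeff μ δ ε s
qCoeffFrom-sumTo μ δ ε s (suc N) j (c ∷ cs) high≡0 = begin
  c * V j + qCoeffFrom μ δ ε s (suc j) cs
    ≡⟨ cong₂ _+_ (cong (λ z → c * V z) (sym (NP.+-identityʳ j)))
         (trans (qCoeffFrom-sumTo μ δ ε s N (suc j) cs (λ k N<k → high≡0 (suc k) (s≤s N<k)))
                (sumTo-ext N (λ k → cong (λ z → nth cs k * V z) (sym (NP.+-suc j k))))) ⟩
  c * V (j N.+ 0) + sumTo (λ k → nth cs k * V (j N.+ suc k)) N
    ≡⟨ sym (sumTo-suc (λ k → nth (c ∷ cs) k * V (j N.+ k)) N) ⟩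
  sumTo (λ k → nth (c ∷ cs) k * V (j N.+ k)) (suc N) ∎
  where V = jCoeff μ δ ε s

-- For f of degree ≤ N, expansion μ δ ε N f w is the coefficient of q^(μ - N + w) in E₄^δ E₆^ε Δ^μ f(j).
expansion : ℤ → Fin 3 → Fin 2 → ℕ → (ℕ → ℚ) → PS
expansion μ δ ε N f w = sumTo (λ i → f i * (monomial (N ∸ i) ⊛ jTerm μ δ ε i) w) N

qCoeff≡expansion : ∀ μ δ ε N P w → (∀ k → N < k → coeff P k ≡ 0ℚ) → w ≤ N →
  qCoeff μ δ ε P (μ Z.- + (N ∸ w)) ≡ expansion μ δ ε N (coeff P) w
qCoeff≡expansion μ δ ε N P w high≡0 w≤N =
  trans (qCoeff-unfold μ δ ε P _) (trans (qCoeffFrom-sumTo μ δ ε _ N 0 P high≡0)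
  (sumTo-cong N (λ i i≤N → cong (nth P i *_)
     (trans (cong (coeffZ (jTerm μ δ ε i)) (exponent i i≤N)) (sym (monomial-⊛ (N ∸ i) (jTerm μ δ ε i) w))))))
  where
  +∸ : ∀ {a b} → b ≤ a → + (a ∸ b) ≡ + a Z.- + b
  +∸ {a} {b} b≤a = sym (trans (ZP.m-n≡m⊖n a b) (ZP.⊖-≥ b≤a))
  shift : ∀ μ n w i → (μ Z.- (n Z.- w)) Z.- μ Z.+ i ≡ w Z.- (n Z.- i)
  shift = solve-∀
  exponent : ∀ i → i ≤ N → (μ Z.- + (N ∸ w)) Z.- μ Z.+ + i ≡ + w Z.- + (N ∸ i)
  exponent i i≤N = begin
    (μ Z.- + (N ∸ w)) Z.- μ Z.+ + i     ≡⟨ cong (λ z → (μ Z.- z) Z.- μ Z.+ + i) (+∸ w≤N) ⟩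
    (μ Z.- (+ N Z.- + w)) Z.- μ Z.+ + i ≡⟨ shift μ (+ N) (+ w) (+ i) ⟩
    + w Z.- (+ N Z.- + i)               ≡⟨ cong (λ z → + w Z.- z) (sym (+∸ i≤N)) ⟩
    + w Z.- + (N ∸ i)                   ∎

δℤ-refl : ∀ x → δℤ x x ≡ 1ℚ
δℤ-refl x with x Z.≟ x
... | yes _   = refl
... | no  x≢x = ⊥-elim (x≢x refl)

δℤ-≢ : ∀ {x y} → x ≢ y → δℤ x y ≡ 0ℚ
δℤ-≢ {x} {y} x≢y with x Z.≟ y
... | yes x≡y = ⊥-elim (x≢y x≡y)
... | no  _   = refl

δℤ-sub : ∀ μ a b → δℤ (μ Z.- + a) (μ Z.- + b) ≡ monomial a b
δℤ-sub μ a b = by-cases (a N.≟ b)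
  where
  sub-involutive : ∀ μ x → μ Z.- (μ Z.- x) ≡ x
  sub-involutive = solve-∀
  sub-injective : μ Z.- + a ≡ μ Z.- + b → a ≡ b
  sub-injective eq = ZP.+-injective
    (trans (sym (sub-involutive μ (+ a))) (trans (cong (λ z → μ Z.- z) eq) (sub-involutive μ (+ b))))
  by-cases : Dec (a ≡ b) → δℤ (μ Z.- + a) (μ Z.- + b) ≡ monomial a b
  by-cases (yes a≡b) = trans (cong (λ z → δℤ (μ Z.- + a) (μ Z.- + z)) (sym a≡b))
                             (trans (δℤ-refl (μ Z.- + a)) (sym (monomial-≡ a≡b)))
  by-cases (no a≢b)  = trans (δℤ-≢ (a≢b ∘ sub-injective)) (sym (monomial-≢ a b a≢b))

expansion-faber : ∀ {μ δ ε m P} → IsFaber μ δ ε m P → ∀ N w → m ≤ N → w ≤ N →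
  expansion μ δ ε N (coeff P) w ≡ monomial (N ∸ w) m
expansion-faber {μ} {δ} {ε} {m} {P} ((_ , high≡0) , lowCoeffs) N w m≤N w≤N = begin
  expansion μ δ ε N (coeff P) w       ≡⟨ sym (qCoeff≡expansion μ δ ε N P w (λ k N<k → high≡0 k (NP.≤-<-trans m≤N N<k)) w≤N) ⟩
  qCoeff μ δ ε P (μ Z.- + (N ∸ w))    ≡⟨ lowCoeffs _ (ZP.i-j≤i μ (+ (N ∸ w))) ⟩
  δℤ (μ Z.- + (N ∸ w)) (μ Z.- + m)    ≡⟨ δℤ-sub μ (N ∸ w) m ⟩
  monomial (N ∸ w) m                  ∎

-- The operator Λ and the recurrence of the Faber polynomials

mulX : (ℕ → ℚ) → ℕ → ℚ
mulX f zero    = 0ℚ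
mulX f (suc j) = f j

-- (Λ a) n is the qⁿ-coefficient of (q·j − X q) · Σₙ aₙ(X) qⁿ.
Λ : (ℕ → ℕ → ℚ) → ℕ → ℕ → ℚ
Λ a zero    i = a 0 i
Λ a (suc n) i = a (suc n) i - mulX (a n) i + sumTo (λ t → qj (suc t) * a (n ∸ t) i) n

⊛-congʳ-≤ : ∀ (f : PS) {g g′ : PS} w → (∀ v → v ≤ w → g v ≡ g′ v) → (f ⊛ g) w ≡ (f ⊛ g′) w
⊛-congʳ-≤ f w g≡g′ = sumTo-cong w (λ v v≤w → cong (f v *_) (g≡g′ (w ∸ v) (NP.m∸n≤m w v)))

expansion-mulX : ∀ μ δ ε n (f : ℕ → ℚ) w →
  expansion μ δ ε (suc n) (mulX f) w ≡ (qj ⊛ expansion μ δ ε n f) w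
expansion-mulX μ δ ε n f w = begin
  sumTo (λ i → mulX f i * K (suc n) i) (suc n)
    ≡⟨ sumTo-suc (λ i → mulX f i * K (suc n) i) n ⟩
  0ℚ * K (suc n) 0 + sumTo (λ i → f i * K (suc n) (suc i)) n
    ≡⟨ trans (cong (_+ sumTo (λ i → f i * K (suc n) (suc i)) n) (QP.*-zeroˡ (K (suc n) 0))) (QP.+-identityˡ _) ⟩
  sumTo (λ i → f i * K (suc n) (suc i)) n
    ≡⟨ sumTo-ext n (λ i → cong (f i *_) (shiftTerm i)) ⟩
  sumTo (λ i → f i * (qj ⊛ (monomial (n ∸ i) ⊛ jTerm μ δ ε i)) w) n
    ≡⟨ sym (⊛-sumTo qj f (λ i → monomial (n ∸ i) ⊛ jTerm μ δ ε i) n w) ⟩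
  (qj ⊛ expansion μ δ ε n f) w ∎
  where
  K : ℕ → ℕ → ℚ
  K N i = (monomial (N ∸ i) ⊛ jTerm μ δ ε i) w
  shiftTerm : ∀ i → K (suc n) (suc i) ≡ (qj ⊛ (monomial (n ∸ i) ⊛ jTerm μ δ ε i)) w
  shiftTerm i =
    ≗-trans (⊛-congʳ (monomial (n ∸ i)) (jTerm-suc μ δ ε i))
    (≗-trans (≗-sym (⊛-assoc (monomial (n ∸ i)) qj (jTerm μ δ ε i)))
    (≗-trans (⊛-congˡ (jTerm μ δ ε i) (⊛-comm (monomial (n ∸ i)) qj))
             (⊛-assoc qj (monomial (n ∸ i)) (jTerm μ δ ε i)))) w

expansion-Λ : ∀ μ δ ε n (a : ℕ → ℕ → ℚ) w →
  expansion μ δ ε (suc n) (Λ a (suc n)) w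
  ≡ expansion μ δ ε (suc n) (a (suc n)) w - expansion μ δ ε (suc n) (mulX (a n)) w
    + sumTo (λ t → qj (suc t) * expansion μ δ ε (suc n) (a (n ∸ t)) w) n
expansion-Λ μ δ ε n a w = begin
  sumTo (λ i → Λ a (suc n) i * K i) (suc n)
    ≡⟨ sumTo-ext (suc n) distrib ⟩
  sumTo (λ i → a (suc n) i * K i - mulX (a n) i * K i + sumTo (λ t → qj (suc t) * (a (n ∸ t) i * K i)) n) (suc n)
    ≡⟨ sumTo-sub-add (λ i → a (suc n) i * K i) (λ i → mulX (a n) i * K i) _ (suc n) ⟩
  expansion μ δ ε (suc n) (a (suc n)) w - expansion μ δ ε (suc n) (mulX (a n)) w
    + sumTo (λ i → sumTo (λ t → qj (suc t) * (a (n ∸ t) i * K i)) n) (suc n)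
    ≡⟨ cong (_+_ (expansion μ δ ε (suc n) (a (suc n)) w - expansion μ δ ε (suc n) (mulX (a n)) w))
            (trans (sumTo-swap (λ i t → qj (suc t) * (a (n ∸ t) i * K i)) (suc n) n)
                   (sumTo-ext n (λ t → sumTo-*ˡ (qj (suc t)) (λ i → a (n ∸ t) i * K i) (suc n)))) ⟩
  expansion μ δ ε (suc n) (a (suc n)) w - expansion μ δ ε (suc n) (mulX (a n)) w
    + sumTo (λ t → qj (suc t) * expansion μ δ ε (suc n) (a (n ∸ t)) w) n ∎
  where
  K : ℕ → ℚ
  K i = (monomial (suc n ∸ i) ⊛ jTerm μ δ ε i) w
  distrib : ∀ i → Λ a (suc n) i * K i
    ≡ a (suc n) i * K i - mulX (a n) i * K i + sumTo (λ t → qj (suc t) * (a (n ∸ t) i * K i)) n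
  distrib i = begin
    (x - y + z) * K i               ≡⟨ solve 4 (λ x y z k → (x :- y :+ z) :* k := x :* k :- y :* k :+ z :* k) refl x y z (K i) ⟩
    x * K i - y * K i + z * K i     ≡⟨ cong (_+_ (x * K i - y * K i)) (sym (sumTo-*ʳ (K i) (λ t → qj (suc t) * a (n ∸ t) i) n)) ⟩
    x * K i - y * K i + sumTo (λ t → qj (suc t) * a (n ∸ t) i * K i) n
                                    ≡⟨ cong (_+_ (x * K i - y * K i)) (sumTo-ext n (λ t → QP.*-assoc (qj (suc t)) (a (n ∸ t) i) (K i))) ⟩
    x * K i - y * K i + sumTo (λ t → qj (suc t) * (a (n ∸ t) i * K i)) n ∎
    where
    x = a (suc n) i
    y = mulX (a n) i
    z = sumTo (λ t → qj (suc t) * a (n ∸ t) i) n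

expansion-triangular : ∀ μ δ ε N (f : ℕ → ℚ) j → j ≤ N → (∀ i → j < i → f i ≡ 0ℚ) →
  expansion μ δ ε N f (N ∸ j) ≡ f j
expansion-triangular μ δ ε N f j j≤N high≡0 = begin
  sumTo (λ i → f i * K i) N   ≡⟨ sumTo-single (λ i → f i * K i) N j j≤N (λ i _ i≢j → others i i≢j (NP.<-cmp i j)) ⟩
  f j * K j                   ≡⟨ cong (f j *_) diagonal ⟩
  f j * 1ℚ                    ≡⟨ QP.*-identityʳ (f j) ⟩
  f j                         ∎
  where
  K : ℕ → ℚ
  K i = (monomial (N ∸ i) ⊛ jTerm μ δ ε i) (N ∸ j)
  diagonal : K j ≡ 1ℚ
  diagonal = trans (monomial-⊛-≥ (N ∸ j) (jTerm μ δ ε j) (N ∸ j) NP.≤-refl)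
                   (trans (cong (jTerm μ δ ε j) (NP.n∸n≡0 (N ∸ j))) (jTerm-constant μ δ ε j))
  others : ∀ i → i ≢ j → Tri (i < j) (i ≡ j) (j < i) → f i * K i ≡ 0ℚ
  others i i≢j (tri≈ _ i≡j _) = ⊥-elim (i≢j i≡j)
  others i _   (tri> _ _ j<i) = trans (cong (_* K i) (high≡0 i j<i)) (QP.*-zeroˡ (K i))
  others i _   (tri< i<j _ _) =
    trans (cong (f i *_) (monomial-⊛-< (N ∸ i) (jTerm μ δ ε i) (N ∸ j) (NP.∸-monoʳ-< i<j j≤N))) (QP.*-zeroʳ (f i))

-- By triangularity the coefficients of f vanish from the top down.
expansion-vanishing⇒constant : ∀ μ δ ε N (f : ℕ → ℚ) → (∀ i → N < i → f i ≡ 0ℚ) →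
  (∀ w → w < N → expansion μ δ ε N f w ≡ 0ℚ) → ∀ i → f (suc i) ≡ 0ℚ
expansion-vanishing⇒constant μ δ ε N f high≡0 expansion≡0 i =
  above (suc N) i (s≤s (NP.≤-trans (NP.n≤1+n N) (NP.m≤n+m (suc N) i)))
  where
  above : ∀ d i → N < suc i N.+ d → f (suc i) ≡ 0ℚ
  above zero    i N<i = high≡0 (suc i) (subst (N <_) (NP.+-identityʳ (suc i)) N<i)
  above (suc d) i N<i+d+1 with N N.<? suc i N.+ d
  ... | yes N<i+d = above d i N<i+d
  ... | no  N≮i+d = trans (sym (expansion-triangular μ δ ε N f (suc i) i<N higher≡0))
                          (expansion≡0 (N ∸ suc i) (NP.∸-monoʳ-< (s≤s z≤n) i<N))
    where
    i+d≤N = NP.≮⇒≥ N≮i+d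
    N≤i+d = NP.≤-pred (subst (N <_) (NP.+-suc (suc i) d) N<i+d+1)
    i<N : suc i ≤ N
    i<N = NP.≤-trans (NP.m≤m+n (suc i) d) i+d≤N
    higher≡0 : ∀ k → suc i < k → f k ≡ 0ℚ
    higher≡0 (suc k) i<k = above d k (NP.<-≤-trans (s≤s N≤i+d) (NP.+-monoˡ-≤ d i<k))

qj-leading-terms : ∀ n w → w ≤ n →
  one w - qj w + sumTo (λ t → qj (suc t) * monomial (suc n ∸ w) (n ∸ t)) n ≡ 0ℚ
qj-leading-terms n zero _ = cong (_+_ (1ℚ - 1ℚ)) (sumTo-zero n (λ t _ →
  trans (cong (qj (suc t) *_) (monomial-≢ (suc n) (n ∸ t) (λ n+1≡n∸t → NP.<⇒≱ (s≤s (NP.m∸n≤m n t)) (NP.≤-reflexive n+1≡n∸t))))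
        (QP.*-zeroʳ (qj (suc t)))))
qj-leading-terms n (suc w) w+1≤n = begin
  0ℚ - qj (suc w) + sumTo (λ t → qj (suc t) * monomial (n ∸ w) (n ∸ t)) n
    ≡⟨ cong (_+_ (0ℚ - qj (suc w))) (sumTo-single _ n w w≤n (λ t t≤n t≢w →
         trans (cong (qj (suc t) *_) (monomial-≢ (n ∸ w) (n ∸ t) (t≢w ∘ sym ∘ NP.∸-cancelˡ-≡ w≤n t≤n)))
               (QP.*-zeroʳ (qj (suc t))))) ⟩
  0ℚ - qj (suc w) + qj (suc w) * monomial (n ∸ w) (n ∸ w)
    ≡⟨ cong (λ z → 0ℚ - qj (suc w) + qj (suc w) * z) (monomial-refl (n ∸ w)) ⟩
  0ℚ - qj (suc w) + qj (suc w) * 1ℚ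
    ≡⟨ solve 1 (λ x → con 0ℚ :- x :+ x :* con 1ℚ := con 0ℚ) refl (qj (suc w)) ⟩
  0ℚ ∎
  where
  w≤n = NP.≤-trans (NP.n≤1+n w) w+1≤n

ScalarΛ : (ℕ → ℕ → ℚ) → Set
ScalarΛ a = (a 0 0 ≡ 1ℚ) × (∀ n i → Λ a n (suc i) ≡ 0ℚ)

module _ {μ δ ε} {P : ℕ → Poly} (faber : ∀ n → IsFaber μ δ ε n (P n)) where

  private
    p : ℕ → ℕ → ℚ
    p n = coeff (P n)

    p-high : ∀ n i → n < i → p n i ≡ 0ℚ
    p-high n = proj₂ (proj₁ (faber n))

    p-expansion : ∀ m N w → m ≤ N → w ≤ N → expansion μ δ ε N (p m) w ≡ monomial (N ∸ w) m
    p-expansion m = expansion-faber {μ} {δ} {ε} {m} {P m} (faber m)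

  Λ-faber-degree : ∀ n j → suc n < j → Λ p (suc n) j ≡ 0ℚ
  Λ-faber-degree n (suc j) (s≤s n<j) = begin
    p (suc n) (suc j) - p n j + sumTo (λ t → qj (suc t) * p (n ∸ t) (suc j)) n
      ≡⟨ cong₂ (λ x y → x - y + sumTo (λ t → qj (suc t) * p (n ∸ t) (suc j)) n)
               (p-high (suc n) (suc j) (s≤s n<j)) (p-high n j n<j) ⟩
    0ℚ - 0ℚ + sumTo (λ t → qj (suc t) * p (n ∸ t) (suc j)) n
      ≡⟨ cong (_+_ (0ℚ - 0ℚ)) (sumTo-zero n (λ t _ → trans (cong (qj (suc t) *_) (p-high (n ∸ t) (suc j)
              (NP.≤-<-trans (NP.m∸n≤m n t) (NP.<-trans n<j (NP.n<1+n j))))) (QP.*-zeroʳ (qj (suc t))))) ⟩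
    0ℚ ∎

  Λ-faber-expansion : ∀ n w → w ≤ n → expansion μ δ ε (suc n) (Λ p (suc n)) w ≡ 0ℚ
  Λ-faber-expansion n w w≤n = begin
    expansion μ δ ε (suc n) (Λ p (suc n)) w
      ≡⟨ expansion-Λ μ δ ε n p w ⟩
    E (p (suc n)) - E (mulX (p n)) + sumTo (λ t → qj (suc t) * E (p (n ∸ t))) n
      ≡⟨ cong₂ (λ x y → x - y + sumTo (λ t → qj (suc t) * E (p (n ∸ t))) n) top shifted ⟩
    one w - qj w + sumTo (λ t → qj (suc t) * E (p (n ∸ t))) n
      ≡⟨ cong (_+_ (one w - qj w)) (sumTo-cong n (λ t t≤n → cong (qj (suc t) *_) (lower t))) ⟩
    one w - qj w + sumTo (λ t → qj (suc t) * monomial (suc n ∸ w) (n ∸ t)) n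
      ≡⟨ qj-leading-terms n w w≤n ⟩
    0ℚ ∎
    where
    E : (ℕ → ℚ) → ℚ
    E f = expansion μ δ ε (suc n) f w
    w≤1+n = NP.m≤n⇒m≤1+n w≤n
    top : E (p (suc n)) ≡ one w
    top = trans (p-expansion (suc n) (suc n) w NP.≤-refl w≤1+n) (monomial-∸-self w≤1+n)
    shifted : E (mulX (p n)) ≡ qj w
    shifted = begin
      E (mulX (p n))                       ≡⟨ expansion-mulX μ δ ε n (p n) w ⟩
      (qj ⊛ expansion μ δ ε n (p n)) w     ≡⟨ ⊛-congʳ-≤ qj w (λ v v≤w → let v≤n = NP.≤-trans v≤w w≤n in
                                                trans (p-expansion n n v NP.≤-refl v≤n) (monomial-∸-self v≤n)) ⟩
      (qj ⊛ one) w                         ≡⟨ ⊛-identityʳ qj w ⟩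
      qj w                                 ∎
    lower : ∀ t → E (p (n ∸ t)) ≡ monomial (suc n ∸ w) (n ∸ t)
    lower t = p-expansion (n ∸ t) (suc n) w (NP.≤-trans (NP.m∸n≤m n t) (NP.n≤1+n n)) w≤1+n

  faber-scalarΛ : ScalarΛ (λ n → coeff (P n))
  faber-scalarΛ = proj₁ (proj₁ (faber 0)) , constant
    where
    constant : ∀ n i → Λ p n (suc i) ≡ 0ℚ
    constant zero    i = p-high 0 (suc i) (s≤s z≤n)
    constant (suc n) = expansion-vanishing⇒constant μ δ ε (suc n) (Λ p (suc n))
      (Λ-faber-degree n) (λ w w<1+n → Λ-faber-expansion n w (NP.≤-pred w<1+n))

-- Scalar Λ-images and the duality of generating functions

convolve : PS → (ℕ → ℕ → ℚ) → ℕ → ℕ → ℚ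
convolve h a n i = (h ⊛ (λ m → a m i)) n

convolve-mulX : ∀ h a n i → sumTo (λ k → h k * mulX (a (n ∸ k)) i) n ≡ mulX (convolve h a n) i
convolve-mulX h a n zero    = sumTo-zero n (λ k _ → QP.*-zeroʳ (h k))
convolve-mulX h a n (suc i) = refl

convolve-qj-tail : ∀ h a n i →
  sumTo (λ k → h k * sumTo (λ t → qj (suc t) * a (n ∸ k ∸ t) i) (n ∸ k)) n
  ≡ sumTo (λ t → qj (suc t) * convolve h a (n ∸ t) i) n
convolve-qj-tail h a n i = begin
  sumTo (λ k → h k * sumTo (λ t → qj (suc t) * a (n ∸ k ∸ t) i) (n ∸ k)) n
    ≡⟨ sumTo-ext n (λ k → sym (sumTo-*ˡ (h k) (λ t → qj (suc t) * a (n ∸ k ∸ t) i) (n ∸ k))) ⟩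
  sumTo (λ k → sumTo (λ t → h k * (qj (suc t) * a (n ∸ k ∸ t) i)) (n ∸ k)) n
    ≡⟨ sumTo-triangle-swap (λ k t → h k * (qj (suc t) * a (n ∸ k ∸ t) i)) n ⟩
  sumTo (λ t → sumTo (λ k → h k * (qj (suc t) * a (n ∸ k ∸ t) i)) (n ∸ t)) n
    ≡⟨ sumTo-ext n (λ t → trans (sumTo-ext (n ∸ t) (λ k →
          trans (cong (λ z → h k * (qj (suc t) * a z i)) (∸-comm n k t))
                (*-left-commute (h k) (qj (suc t)) (a (n ∸ t ∸ k) i))))
         (sumTo-*ˡ (qj (suc t)) (λ k → h k * a (n ∸ t ∸ k) i) (n ∸ t))) ⟩
  sumTo (λ t → qj (suc t) * convolve h a (n ∸ t) i) n ∎
  where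
  ∸-comm : ∀ n k t → n ∸ k ∸ t ≡ n ∸ t ∸ k
  ∸-comm n k t = trans (NP.∸-+-assoc n k t) (trans (cong (n ∸_) (NP.+-comm k t)) (sym (NP.∸-+-assoc n t k)))

Λ-convolve : ∀ h a n i → Λ (convolve h a) n i ≡ (h ⊛ (λ m → Λ a m i)) n
Λ-convolve h a zero    i = refl
Λ-convolve h a (suc n) i = sym (begin
  sumTo (λ k → h k * Λ a (suc n ∸ k) i) n + h (suc n) * Λ a (suc n ∸ suc n) i
    ≡⟨ cong₂ _+_ (sumTo-cong n (λ k k≤n → cong (λ z → h k * Λ a z i) (NP.+-∸-assoc 1 k≤n)))
                 (cong (λ z → h (suc n) * Λ a z i) (NP.n∸n≡0 n)) ⟩
  sumTo (λ k → h k * Λ a (suc (n ∸ k)) i) n + last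
    ≡⟨ cong (_+ last) (trans (sumTo-ext n (λ k →
          solve 4 (λ x y z w → x :* (y :- z :+ w) := x :* y :- x :* z :+ x :* w) refl
            (h k) (a (suc (n ∸ k)) i) (mulX (a (n ∸ k)) i) (sumTo (λ t → qj (suc t) * a (n ∸ k ∸ t) i) (n ∸ k))))
          (sumTo-sub-add (λ k → h k * a (suc (n ∸ k)) i) (λ k → h k * mulX (a (n ∸ k)) i)
                         (λ k → h k * sumTo (λ t → qj (suc t) * a (n ∸ k ∸ t) i) (n ∸ k)) n)) ⟩
  (head - shifted + tail) + last
    ≡⟨ solve 4 (λ x y z w → (x :- y :+ z) :+ w := (x :+ w) :- y :+ z) refl head shifted tail last ⟩
  (head + last) - shifted + tail
    ≡⟨ cong₂ (λ x y → x - y + tail) full (convolve-mulX h a n i) ⟩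
  convolve h a (suc n) i - mulX (convolve h a n) i + tail
    ≡⟨ cong (_+_ (convolve h a (suc n) i - mulX (convolve h a n) i)) (convolve-qj-tail h a n i) ⟩
  convolve h a (suc n) i - mulX (convolve h a n) i + sumTo (λ t → qj (suc t) * convolve h a (n ∸ t) i) n ∎)
  where
  head    = sumTo (λ k → h k * a (suc (n ∸ k)) i) n
  shifted = sumTo (λ k → h k * mulX (a (n ∸ k)) i) n
  tail    = sumTo (λ k → h k * sumTo (λ t → qj (suc t) * a (n ∸ k ∸ t) i) (n ∸ k)) n
  last    = h (suc n) * a 0 i
  full : head + last ≡ convolve h a (suc n) i
  full = cong₂ _+_ (sumTo-cong n (λ k k≤n → cong (λ z → h k * a z i) (sym (NP.+-∸-assoc 1 k≤n))))
                   (cong (λ z → h (suc n) * a z i) (sym (NP.n∸n≡0 n)))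

Λ-injective : ∀ (a b : ℕ → ℕ → ℚ) → (∀ n i → Λ a n i ≡ Λ b n i) → ∀ n i → a n i ≡ b n i
Λ-injective a b Λa≡Λb n = below n n NP.≤-refl
  where
  invert : ∀ (c : ℕ → ℕ → ℚ) m i →
    c (suc m) i ≡ Λ c (suc m) i + mulX (c m) i - sumTo (λ t → qj (suc t) * c (m ∸ t) i) m
  invert c m i = solve 3 (λ x y z → x := (x :- y :+ z) :+ y :- z) refl
    (c (suc m) i) (mulX (c m) i) (sumTo (λ t → qj (suc t) * c (m ∸ t) i) m)
  below : ∀ N m → m ≤ N → ∀ i → a m i ≡ b m i
  below N zero _ i = Λa≡Λb 0 i
  below (suc N) (suc m) (s≤s m≤N) i = begin
    a (suc m) i
      ≡⟨ invert a m i ⟩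
    Λ a (suc m) i + mulX (a m) i - sumTo (λ t → qj (suc t) * a (m ∸ t) i) m
      ≡⟨ cong₂ (λ x y → x + y - sumTo (λ t → qj (suc t) * a (m ∸ t) i) m) (Λa≡Λb (suc m) i) (mulX-eq i) ⟩
    Λ b (suc m) i + mulX (b m) i - sumTo (λ t → qj (suc t) * a (m ∸ t) i) m
      ≡⟨ cong (λ z → Λ b (suc m) i + mulX (b m) i - z)
           (sumTo-cong m (λ t t≤m → cong (qj (suc t) *_) (below N (m ∸ t) (NP.≤-trans (NP.m∸n≤m m t) m≤N) i))) ⟩
    Λ b (suc m) i + mulX (b m) i - sumTo (λ t → qj (suc t) * b (m ∸ t) i) m
      ≡⟨ sym (invert b m i) ⟩
    b (suc m) i ∎
    where
    mulX-eq : ∀ i → mulX (a m) i ≡ mulX (b m) i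
    mulX-eq zero    = refl
    mulX-eq (suc i) = below N m m≤N i

Λ₀ : (ℕ → ℕ → ℚ) → PS
Λ₀ a n = Λ a n 0

scalarΛ-Λ : ∀ {a} → ScalarΛ a → ∀ n i → Λ a n i ≡ Λ₀ a n * one i
scalarΛ-Λ {a} _              n zero    = sym (QP.*-identityʳ (Λ₀ a n))
scalarΛ-Λ {a} (_ , constant) n (suc i) = trans (constant n i) (sym (QP.*-zeroʳ (Λ₀ a n)))

-- Both sides have Λ-image (Λ₀ a ⊛ Λ₀ b) · 1, i.e. Λ₀ b · Σ aₙ qⁿ = Λ₀ a · Σ bₙ qⁿ.
scalarΛ-cross : ∀ {a b} → ScalarΛ a → ScalarΛ b → ∀ n i → convolve (Λ₀ b) a n i ≡ convolve (Λ₀ a) b n i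
scalarΛ-cross {a} {b} scalar-a scalar-b = Λ-injective (convolve (Λ₀ b) a) (convolve (Λ₀ a) b) (λ n i → begin
  Λ (convolve (Λ₀ b) a) n i          ≡⟨ image (Λ₀ b) scalar-a n i ⟩
  (Λ₀ b ⊛ Λ₀ a) n * one i            ≡⟨ cong (_* one i) (⊛-comm (Λ₀ b) (Λ₀ a) n) ⟩
  (Λ₀ a ⊛ Λ₀ b) n * one i            ≡⟨ sym (image (Λ₀ a) scalar-b n i) ⟩
  Λ (convolve (Λ₀ a) b) n i          ∎)
  where
  image : ∀ h {c} → ScalarΛ c → ∀ n i → Λ (convolve h c) n i ≡ (h ⊛ Λ₀ c) n * one i
  image h {c} scalar-c n i = begin
    Λ (convolve h c) n i                   ≡⟨ Λ-convolve h c n i ⟩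
    sumTo (λ k → h k * Λ c (n ∸ k) i) n    ≡⟨ sumTo-ext n (λ k → trans (cong (h k *_) (scalarΛ-Λ scalar-c (n ∸ k) i))
                                                (sym (QP.*-assoc (h k) (Λ₀ c (n ∸ k)) (one i)))) ⟩
    sumTo (λ k → h k * Λ₀ c (n ∸ k) * one i) n ≡⟨ sumTo-*ʳ (one i) (λ k → h k * Λ₀ c (n ∸ k)) n ⟩
    (h ⊛ Λ₀ c) n * one i                   ∎

record LinearFunctional : Set where
  field
    apply          : (ℕ → ℚ) → ℚ
    apply-cong     : ∀ {f g : ℕ → ℚ} → f ≗ g → apply f ≡ apply g
    apply-convolve : ∀ h a n → apply (convolve h a n) ≡ (h ⊛ (λ m → apply (a m))) n

open LinearFunctional

scalarΛ-duality : ∀ {a b} → ScalarΛ a → ScalarΛ b → (A B : LinearFunctional) → ∀ n →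
  sumTo (λ d → apply A (a d) * apply B (b (n ∸ d))) n ≡ sumTo (λ d → apply A (b (n ∸ d)) * apply B (a d)) n
scalarΛ-duality {a} {b} scalar-a scalar-b A B n = begin
  ((λ m → apply A (a m)) ⊛ (λ m → apply B (b m))) n
    ≡⟨ ⊛-cross-multiply (Λ₀ a) (Λ₀ b) (λ m → apply A (a m)) (λ m → apply A (b m))
         (λ m → apply B (a m)) (λ m → apply B (b m)) (proj₁ scalar-a) (proj₁ scalar-b) (transfer A) (transfer B) n ⟩
  ((λ m → apply B (a m)) ⊛ (λ m → apply A (b m))) n
    ≡⟨ sumTo-ext n (λ d → QP.*-comm (apply B (a d)) (apply A (b (n ∸ d)))) ⟩
  sumTo (λ d → apply A (b (n ∸ d)) * apply B (a d)) n ∎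
  where
  transfer : ∀ C → (Λ₀ b ⊛ (λ m → apply C (a m))) ≗ (Λ₀ a ⊛ (λ m → apply C (b m)))
  transfer C m = begin
    (Λ₀ b ⊛ (λ m → apply C (a m))) m   ≡⟨ sym (apply-convolve C (Λ₀ b) a m) ⟩
    apply C (convolve (Λ₀ b) a m)      ≡⟨ apply-cong C (scalarΛ-cross scalar-a scalar-b m) ⟩
    apply C (convolve (Λ₀ a) b m)      ≡⟨ apply-convolve C (Λ₀ a) b m ⟩
    (Λ₀ a ⊛ (λ m → apply C (b m))) m   ∎

-- Coordinates in the Atkin-like bases as linear functionals

coeff-⊕ : ∀ P Q i → coeff (P ⊕ Q) i ≡ coeff P i + coeff Q i
coeff-⊕ []       Q        i       = sym (QP.+-identityˡ (coeff Q i))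
coeff-⊕ (x ∷ xs) []       i       = sym (QP.+-identityʳ (coeff (x ∷ xs) i))
coeff-⊕ (x ∷ xs) (y ∷ ys) zero    = refl
coeff-⊕ (x ∷ xs) (y ∷ ys) (suc i) = coeff-⊕ xs ys i

coeff-· : ∀ c P i → coeff (c · P) i ≡ c * coeff P i
coeff-· c []       i       = sym (QP.*-zeroʳ c)
coeff-· c (x ∷ xs) zero    = refl
coeff-· c (x ∷ xs) (suc i) = coeff-· c xs i

coeff-⊖· : ∀ P c Q i → coeff (P ⊖ (c · Q)) i ≡ coeff P i + (- 1ℚ) * (c * coeff Q i)
coeff-⊖· P c Q i = trans (coeff-⊕ P ((- 1ℚ) · (c · Q)) i)
  (cong (_+_ (coeff P i)) (trans (coeff-· (- 1ℚ) (c · Q) i) (cong ((- 1ℚ) *_) (coeff-· c Q i))))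

-- coordsDeg, acting on coefficient functions instead of lists
mutual
  coordsFun : (ℕ → Poly) → ℕ → (ℕ → ℚ) → ℕ → ℚ
  coordsFun B zero    f zero    = f 0
  coordsFun B zero    f (suc _) = 0ℚ
  coordsFun B (suc n) f j       = coordsFun-step B n f j (j N.≟ suc n)

  coordsFun-step : (B : ℕ → Poly) (n : ℕ) (f : ℕ → ℚ) (j : ℕ) → Dec (j ≡ suc n) → ℚ
  coordsFun-step B n f j (yes _) = f (suc n)
  coordsFun-step B n f j (no  _) = coordsFun B n (λ i → f i + (- 1ℚ) * (f (suc n) * coeff (B (suc n)) i)) j

coordsFun-cong : ∀ B n {f g : ℕ → ℚ} → f ≗ g → ∀ j → coordsFun B n f j ≡ coordsFun B n g j
coordsFun-cong B zero    f≗g zero    = f≗g 0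
coordsFun-cong B zero    f≗g (suc j) = refl
coordsFun-cong B (suc n) {f} {g} f≗g j = by-cases (j N.≟ suc n)
  where
  by-cases : ∀ d → coordsFun-step B n f j d ≡ coordsFun-step B n g j d
  by-cases (yes _) = f≗g (suc n)
  by-cases (no  _) = coordsFun-cong B n (λ i → cong₂ (λ x y → x + (- 1ℚ) * (y * coeff (B (suc n)) i)) (f≗g i) (f≗g (suc n))) j

coordsDeg≡coordsFun : ∀ B n P j → coordsDeg B n P j ≡ coordsFun B n (coeff P) j
coordsDeg≡coordsFun B zero    P zero    = refl
coordsDeg≡coordsFun B zero    P (suc j) = refl
coordsDeg≡coordsFun B (suc n) P j with j N.≟ suc n
... | yes _ = refl
... | no  _ = trans (coordsDeg≡coordsFun B n (P ⊖ (coeff P (suc n) · B (suc n))) j)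
                    (coordsFun-cong B n (coeff-⊖· P (coeff P (suc n)) (B (suc n))) j)

coordsFun-+ : ∀ B n (f g : ℕ → ℚ) j → coordsFun B n (λ i → f i + g i) j ≡ coordsFun B n f j + coordsFun B n g j
coordsFun-+ B zero    f g zero    = refl
coordsFun-+ B zero    f g (suc j) = sym (QP.+-identityʳ 0ℚ)
coordsFun-+ B (suc n) f g j = by-cases (j N.≟ suc n)
  where
  b = coeff (B (suc n))
  by-cases : ∀ d → coordsFun-step B n (λ i → f i + g i) j d ≡ coordsFun-step B n f j d + coordsFun-step B n g j d
  by-cases (yes _) = refl
  by-cases (no  _) = trans
    (coordsFun-cong B n (λ i → solve 5 (λ x y u v c → (x :+ y) :+ con (- 1ℚ) :* ((u :+ v) :* c)
                          := (x :+ con (- 1ℚ) :* (u :* c)) :+ (y :+ con (- 1ℚ) :* (v :* c))) refl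
                          (f i) (g i) (f (suc n)) (g (suc n)) (b i)) j)
    (coordsFun-+ B n (λ i → f i + (- 1ℚ) * (f (suc n) * b i)) (λ i → g i + (- 1ℚ) * (g (suc n) * b i)) j)

coordsFun-* : ∀ B n c (f : ℕ → ℚ) j → coordsFun B n (λ i → c * f i) j ≡ c * coordsFun B n f j
coordsFun-* B zero    c f zero    = refl
coordsFun-* B zero    c f (suc j) = sym (QP.*-zeroʳ c)
coordsFun-* B (suc n) c f j = by-cases (j N.≟ suc n)
  where
  b = coeff (B (suc n))
  by-cases : ∀ d → coordsFun-step B n (λ i → c * f i) j d ≡ c * coordsFun-step B n f j d
  by-cases (yes _) = refl
  by-cases (no  _) = trans
    (coordsFun-cong B n (λ i → solve 4 (λ k x u v → k :* x :+ con (- 1ℚ) :* ((k :* u) :* v)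
                          := k :* (x :+ con (- 1ℚ) :* (u :* v))) refl c (f i) (f (suc n)) (b i)) j)
    (coordsFun-* B n c (λ i → f i + (- 1ℚ) * (f (suc n) * b i)) j)

coordsFun-sumTo : ∀ B N (F : ℕ → ℕ → ℚ) n j →
  coordsFun B N (λ i → sumTo (λ k → F k i) n) j ≡ sumTo (λ k → coordsFun B N (F k) j) n
coordsFun-sumTo B N F zero    j = refl
coordsFun-sumTo B N F (suc n) j = trans (coordsFun-+ B N (λ i → sumTo (λ k → F k i) n) (F (suc n)) j)
  (cong (_+ coordsFun B N (F (suc n)) j) (coordsFun-sumTo B N F n j))

coordsFun-convolve : ∀ B N h a n j → coordsFun B N (convolve h a n) j ≡ (h ⊛ (λ m → coordsFun B N (a m) j)) n
coordsFun-convolve B N h a n j = trans (coordsFun-sumTo B N (λ k i → h k * a (n ∸ k) i) n j)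
  (sumTo-ext n (λ k → coordsFun-* B N (h k) (a (n ∸ k)) j))

coordsFun-above : ∀ B n f j → n < j → coordsFun B n f j ≡ 0ℚ
coordsFun-above B zero    f (suc j) _   = refl
coordsFun-above B (suc n) f j       n<j = by-cases (j N.≟ suc n)
  where
  by-cases : ∀ d → coordsFun-step B n f j d ≡ 0ℚ
  by-cases (yes j≡1+n) = ⊥-elim (NP.<-irrefl (sym j≡1+n) n<j)
  by-cases (no  _)     = coordsFun-above B n _ j (NP.<-trans (NP.n<1+n n) n<j)

coordsFun-stable-+ : ∀ B d k (f : ℕ → ℚ) → (∀ i → d < i → f i ≡ 0ℚ) →
  ∀ j → coordsFun B d f j ≡ coordsFun B (d N.+ k) f j
coordsFun-stable-+ B d zero    f high≡0 j = cong (λ z → coordsFun B z f j) (sym (NP.+-identityʳ d))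
coordsFun-stable-+ B d (suc k) f high≡0 j = begin
  coordsFun B d f j              ≡⟨ coordsFun-stable-+ B d k f high≡0 j ⟩
  coordsFun B (d N.+ k) f j      ≡⟨ sym (by-cases (j N.≟ suc (d N.+ k))) ⟩
  coordsFun B (suc d N.+ k) f j  ≡⟨ cong (λ z → coordsFun B z f j) (sym (NP.+-suc d k)) ⟩
  coordsFun B (d N.+ suc k) f j  ∎
  where
  top≡0 : f (suc (d N.+ k)) ≡ 0ℚ
  top≡0 = high≡0 (suc (d N.+ k)) (s≤s (NP.m≤m+n d k))
  by-cases : ∀ e → coordsFun-step B (d N.+ k) f j e ≡ coordsFun B (d N.+ k) f j
  by-cases (yes j≡top) = trans top≡0 (sym (trans (sym (coordsFun-stable-+ B d k f high≡0 j))
    (coordsFun-above B d f j (subst (d <_) (sym j≡top) (s≤s (NP.m≤m+n d k))))))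
  by-cases (no  _) = coordsFun-cong B (d N.+ k) (λ i →
    trans (cong (λ z → f i + (- 1ℚ) * (z * coeff (B (suc (d N.+ k))) i)) top≡0)
          (solve 2 (λ x b → x :+ con (- 1ℚ) :* (con 0ℚ :* b) := x) refl (f i) (coeff (B (suc (d N.+ k))) i))) j

coordsFun-stable : ∀ B d N (f : ℕ → ℚ) → d ≤ N → (∀ i → d < i → f i ≡ 0ℚ) →
  ∀ j → coordsFun B d f j ≡ coordsFun B N f j
coordsFun-stable B d N f d≤N high≡0 j =
  trans (coordsFun-stable-+ B d (N ∸ d) f high≡0 j) (cong (λ z → coordsFun B z f j) (NP.m+[n∸m]≡n d≤N))

coordsAt : (ℕ → Poly) → ℕ → (ℕ → ℚ) → ℤ → ℚ
coordsAt B n f -[1+ _ ] = 0ℚ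
coordsAt B n f (+ j)    = coordsFun B n f j

-- coord guards the degree (j ≤ n) explicitly, coordsAt relies on coordsFun vanishing above n.
coord≡coordsAt : ∀ δ ε n P r → coord δ ε n P r ≡ coordsAt (byDeg δ ε) n (coeff P) (r Z.- offset δ ε)
coord≡coordsAt δ ε n P r with r Z.- offset δ ε
... | -[1+ _ ] = refl
... | + j with j N.≤? n
...   | yes _   = coordsDeg≡coordsFun (byDeg δ ε) n P j
...   | no  j≰n = sym (coordsFun-above (byDeg δ ε) n (coeff P) j (NP.≰⇒> j≰n))

coordsAt-cong : ∀ B n {f g : ℕ → ℚ} → f ≗ g → ∀ z → coordsAt B n f z ≡ coordsAt B n g z
coordsAt-cong B n f≗g -[1+ _ ] = refl
coordsAt-cong B n f≗g (+ j)    = coordsFun-cong B n f≗g j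

coordsAt-convolve : ∀ B N h a n z → coordsAt B N (convolve h a n) z ≡ (h ⊛ (λ m → coordsAt B N (a m) z)) n
coordsAt-convolve B N h a n -[1+ _ ] = sym (sumTo-zero n (λ k _ → QP.*-zeroʳ (h k)))
coordsAt-convolve B N h a n (+ j)    = coordsFun-convolve B N h a n j

coordsAt-stable : ∀ B d N (f : ℕ → ℚ) → d ≤ N → (∀ i → d < i → f i ≡ 0ℚ) →
  ∀ z → coordsAt B d f z ≡ coordsAt B N f z
coordsAt-stable B d N f d≤N high≡0 -[1+ _ ] = refl
coordsAt-stable B d N f d≤N high≡0 (+ j)    = coordsFun-stable B d N f d≤N high≡0 j

coordinate : Fin 3 → Fin 2 → ℕ → ℤ → LinearFunctional
coordinate δ ε n r = record
  { apply          = λ f → coordsAt (byDeg δ ε) n f (r Z.- offset δ ε)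
  ; apply-cong     = λ f≗g → coordsAt-cong (byDeg δ ε) n f≗g (r Z.- offset δ ε)
  ; apply-convolve = λ h a m → coordsAt-convolve (byDeg δ ε) n h a m (r Z.- offset δ ε)
  }

coefficient : ℕ → LinearFunctional
coefficient i = record
  { apply          = λ f → f i
  ; apply-cong     = λ f≗g → f≗g i
  ; apply-convolve = λ h a n → refl
  }

coord-lift : ∀ δ ε {d n P} r → d ≤ n → (∀ i → d < i → coeff P i ≡ 0ℚ) →
  coord δ ε d P r ≡ apply (coordinate δ ε n r) (coeff P)
coord-lift δ ε {d} {n} {P} r d≤n high≡0 =
  trans (coord≡coordsAt δ ε d P r) (coordsAt-stable (byDeg δ ε) d n (coeff P) d≤n high≡0 (r Z.- offset δ ε))


faber-coord-lift : ∀ {μ δ ε d n P} δ′ ε′ r → IsFaber μ δ ε d P → d ≤ n →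
  coord δ′ ε′ d P r ≡ apply (coordinate δ′ ε′ n r) (coeff P)
faber-coord-lift δ′ ε′ r ((_ , high≡0) , _) d≤n = coord-lift δ′ ε′ r d≤n high≡0

dual-weight : ∀ m δ ε → wt (Z.- m Z.- + 1) (comp3 δ) (comp2 ε) ≡ + 2 Z.- wt m δ ε
dual-weight m δ ε = trans
  (cong₂ (λ a b → + 12 Z.* (Z.- m Z.- + 1) Z.+ + 4 Z.* a Z.+ + 6 Z.* b) (finℤ-comp3 δ) (finℤ-comp2 ε))
  (complement m (finℤ δ) (finℤ ε))
  where
  finℤ-comp3 : ∀ δ → finℤ (comp3 δ) ≡ + 2 Z.- finℤ δ
  finℤ-comp3 fzero               = refl
  finℤ-comp3 (fsuc fzero)        = refl
  finℤ-comp3 (fsuc (fsuc fzero)) = refl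
  finℤ-comp2 : ∀ ε → finℤ (comp2 ε) ≡ + 1 Z.- finℤ ε
  finℤ-comp2 fzero        = refl
  finℤ-comp2 (fsuc fzero) = refl
  complement : ∀ m a b →
    + 12 Z.* (Z.- m Z.- + 1) Z.+ + 4 Z.* (+ 2 Z.- a) Z.+ + 6 Z.* (+ 1 Z.- b)
    ≡ + 2 Z.- (+ 12 Z.* m Z.+ + 4 Z.* a Z.+ + 6 Z.* b)
  complement = solve-∀

corollary4p6 : (F : ℤ → ℕ → Poly) →
    (∀ (μ : ℤ) (δ' : Fin 3) (ε' : Fin 2) (n : ℕ) → IsFaber μ δ' ε' n (F (wt μ δ' ε') n)) →
    (m : ℤ) (δ : Fin 3) (ε : Fin 2) (n : ℕ) (ℓ ℓ' : ℤ) →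
    Admissible δ ε ℓ →
    Admissible (comp3 δ) (comp2 ε) ℓ' →
    (∀ (i : ℕ) →
      sumTo (λ d → coord δ ε d (F (wt m δ ε) d) ℓ * coeff (F (+ 2 Z.- wt m δ ε) (n ∸ d)) i) n
      ≡ sumTo (λ d → coord δ ε (n ∸ d) (F (+ 2 Z.- wt m δ ε) (n ∸ d)) ℓ * coeff (F (wt m δ ε) d) i) n)
    ×
    (sumTo (λ d → coord δ ε d (F (wt m δ ε) d) ℓ
                  * coord (comp3 δ) (comp2 ε) (n ∸ d) (F (+ 2 Z.- wt m δ ε) (n ∸ d)) ℓ') n
      ≡ sumTo (λ d → coord δ ε (n ∸ d) (F (+ 2 Z.- wt m δ ε) (n ∸ d)) ℓ
                  * coord (comp3 δ) (comp2 ε) d (F (wt m δ ε) d) ℓ') n)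
corollary4p6 F isFaber m δ ε n ℓ ℓ' _ _ =
  (λ i → trans
    (sumTo-cong n (λ d d≤n → cong (_* coeff (F₂₋ₖ (n ∸ d)) i) (liftₖ δ ε ℓ d d≤n)))
    (trans (scalarΛ-duality scalarₖ scalar₂₋ₖ (coordinate δ ε n ℓ) (coefficient i) n)
           (sumTo-ext n (λ d → cong (_* coeff (Fₖ d) i) (sym (lift₂₋ₖ δ ε ℓ d)))))) ,
  trans
    (sumTo-cong n (λ d d≤n → cong₂ _*_ (liftₖ δ ε ℓ d d≤n) (lift₂₋ₖ (comp3 δ) (comp2 ε) ℓ' d)))
    (trans (scalarΛ-duality scalarₖ scalar₂₋ₖ (coordinate δ ε n ℓ) (coordinate (comp3 δ) (comp2 ε) n ℓ') n)
           (sumTo-cong n (λ d d≤n → sym (cong₂ _*_ (lift₂₋ₖ δ ε ℓ d) (liftₖ (comp3 δ) (comp2 ε) ℓ' d d≤n)))))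
  where
  Fₖ F₂₋ₖ : ℕ → Poly
  Fₖ   = F (wt m δ ε)
  F₂₋ₖ = F (+ 2 Z.- wt m δ ε)
  faberₖ : ∀ d → IsFaber m δ ε d (Fₖ d)
  faberₖ = isFaber m δ ε
  faber₂₋ₖ : ∀ d → IsFaber (Z.- m Z.- + 1) (comp3 δ) (comp2 ε) d (F₂₋ₖ d)
  faber₂₋ₖ d = subst (λ κ → IsFaber _ _ _ d (F κ d)) (dual-weight m δ ε) (isFaber _ (comp3 δ) (comp2 ε) d)
  scalarₖ : ScalarΛ (λ d → coeff (Fₖ d))
  scalarₖ = faber-scalarΛ {m} {δ} {ε} {Fₖ} faberₖ
  scalar₂₋ₖ : ScalarΛ (λ d → coeff (F₂₋ₖ d))
  scalar₂₋ₖ = faber-scalarΛ {Z.- m Z.- + 1} {comp3 δ} {comp2 ε} {F₂₋ₖ} faber₂₋ₖ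
  liftₖ : ∀ δ′ ε′ r d → d ≤ n → coord δ′ ε′ d (Fₖ d) r ≡ apply (coordinate δ′ ε′ n r) (coeff (Fₖ d))
  liftₖ δ′ ε′ r d = faber-coord-lift δ′ ε′ r (faberₖ d)
  lift₂₋ₖ : ∀ δ′ ε′ r d →
    coord δ′ ε′ (n ∸ d) (F₂₋ₖ (n ∸ d)) r ≡ apply (coordinate δ′ ε′ n r) (coeff (F₂₋ₖ (n ∸ d)))
  lift₂₋ₖ δ′ ε′ r d = faber-coord-lift δ′ ε′ r (faber₂₋ₖ (n ∸ d)) (NP.m∸n≤m n d)
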